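{- Let $\Sigma$ be a finite totally ordered alphabet, $\mathcal{M}=(T_1,\dots,T_m)$ an ordered collection of nonempty strings over $\Sigma$, and let $L$ be any of $\mathrm{dolEBWT}(\mathcal{M})$, $\mathrm{mdolEBWT}(\mathcal{M})$, $\mathrm{mdolBWT}(\mathcal{M})$, or the adapted $\mathrm{concatBWT}(\mathcal{M})$. Then there exists a permutation $\tau$ of $\{1,\dots,m\}$ such that $L \mathrel{\hat{=}} \mathrm{mdolEBWT}(T_{\tau(1)},\dots,T_{\tau(m)}) \mathrel{\hat{=}} \mathrm{mdolBWT}(T_{\tau(1)},\dots,T_{\tau(m)})$.
   Context: $\mathrm{BWT}(T)$ is the string of last characters of all conjugates (rotations $T[i..n]T[1..i-1]$) of $T$ in lexicographic order. For a string $T$, $T^\omega=TTT\cdots$; $T=U^k$ with $U$ primitive, $k=\exp(T)$; omega-order: $S\prec_\omega T$ iff $S^\omega<_{\mathrm{lex}}T^\omega$, or $S^\omega=T^\omega$ and $\exp(S)<\exp(T)$. For a multiset $\mathcal{N}$, $\mathrm{EBWT}(\mathcal{N})$ is the concatenation of last characters of all conjugates of all strings of $\mathcal{N}$ listed in omega-order. Separator symbols $\$$ and $\$_1<\dots<\$_m$ are smaller than every character of $\Sigma$, and $\#$ is smaller than all of them. Definitions: $\mathrm{dolEBWT}(\mathcal{M})=\mathrm{EBWT}(\{T_d\$ : 1\le d\le m\})$; for an ordered collection $(U_1,\dots,U_m)$, $\mathrm{mdolEBWT}(U_1,\dots,U_m)=\mathrm{EBWT}(\{U_d\$_d\})$ and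 $\mathrm{mdolBWT}(U_1,\dots,U_m)=\mathrm{BWT}(U_1\$_1\cdots U_m\$_m)$; $\mathrm{concatBWT}(\mathcal{M})=\mathrm{BWT}(T_1\$T_2\$\cdots T_m\$\#)$, and the adapted $\mathrm{concatBWT}$ is obtained from it by deleting its first character and replacing the $\#$ by $\$$. Two strings satisfy $L\mathrel{\hat{=}}L'$ if they become equal after every separator symbol ($\$$, $\$_j$) in each is replaced by one common symbol $\$$. -}

module Defs where

open import Data.Nat using (ℕ; zero; suc; _<_; _≤_)
open import Data.Fin using (Fin; toℕ)
import Data.Fin as F
open import Data.List using (List; []; _∷_; _++_; map; concat; concatMap; replicate; drop; take; length; tabulate; upTo)
open import Data.List.Relation.Unary.Linked using (Linked)
open import Data.List.Relation.Binary.Permutation.Propositional using (_↭_)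
open import Data.Product using (Σ; ∃; _×_; _,_)
open import Data.Sum using (_⊎_)
open import Relation.Nullary using (¬_)
open import Relation.Binary.PropositionalEquality using (_≡_; _≢_)

-- Alphabet Σ = Fin σ (a finite totally ordered alphabet, ordered as Fin).
-- Extended symbols: # < $ < $_1 < $_2 < ... < every character of Σ.
data Sym (σ : ℕ) : Set where
  hash : Sym σ
  dol  : Sym σ
  sep  : ℕ → Sym σ
  chr  : Fin σ → Sym σ

data _<S_ {σ : ℕ} : Sym σ → Sym σ → Set where
  h<d : hash <S dol
  h<s : ∀ {j} → hash <S sep j
  h<c : ∀ {c} → hash <S chr c
  d<s : ∀ {j} → dol <S sep j
  d<c : ∀ {c} → dol <S chr c
  s<s : ∀ {i j} → i < j → sep i <S sep j
  s<c : ∀ {j c} → sep j <S chr c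
  c<c : ∀ {a b} → a F.< b → chr a <S chr b

Str : ℕ → Set
Str σ = List (Sym σ)

data _<lex_ {σ : ℕ} : Str σ → Str σ → Set where
  []<∷  : ∀ {y ys} → [] <lex (y ∷ ys)
  here  : ∀ {x y xs ys} → x <S y → (x ∷ xs) <lex (y ∷ ys)
  there : ∀ {x xs ys} → xs <lex ys → (x ∷ xs) <lex (x ∷ ys)

-- i-th symbol with a default (only used on in-range indices)
at : ∀ {σ} → Str σ → ℕ → Sym σ
at []       _       = hash
at (x ∷ _)  zero    = x
at (_ ∷ xs) (suc i) = at xs i

pow : ∀ {σ} → Str σ → ℕ → Str σ
pow U k = concat (replicate k U)

omega : ∀ {σ} → Str σ → ℕ → Sym σ
omega T i = at (pow T (suc i)) i

_<ω-lex_ : ∀ {σ} → Str σ → Str σ → Set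
S <ω-lex T = ∃ λ k → (∀ j → j < k → omega S j ≡ omega T j) × (omega S k <S omega T k)

_=ω_ : ∀ {σ} → Str σ → Str σ → Set
S =ω T = ∀ i → omega S i ≡ omega T i

Primitive : ∀ {σ} → Str σ → Set
Primitive U = U ≢ [] × (∀ V k → U ≡ pow V k → k ≡ 1)

IsExp : ∀ {σ} → Str σ → ℕ → Set
IsExp T k = ∃ λ U → Primitive U × T ≡ pow U k

_≺ω_ : ∀ {σ} → Str σ → Str σ → Set
S ≺ω T = (S <ω-lex T) ⊎ ((S =ω T) × ∃ λ a → ∃ λ b → IsExp S a × IsExp T b × a < b)

-- last character (strings considered are nonempty)
lastSym : ∀ {σ} → Str σ → Sym σ
lastSym []           = hash
lastSym (x ∷ [])     = x
lastSym (_ ∷ y ∷ xs) = lastSym (y ∷ xs)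

-- rotation T[i+1..n] T[1..i] (0-based shift i)
rot : ∀ {σ} → ℕ → Str σ → Str σ
rot i T = drop i T ++ take i T

conjugates : ∀ {σ} → Str σ → List (Str σ)
conjugates T = map (λ i → rot i T) (upTo (length T))

SortedBy : ∀ {A : Set} → (A → A → Set) → List A → Set
SortedBy _≺_ = Linked (λ x y → ¬ (y ≺ x))

IsBWT : ∀ {σ} → Str σ → Str σ → Set
IsBWT T L = ∃ λ C → (C ↭ conjugates T) × SortedBy _<lex_ C × L ≡ map lastSym C

-- L = EBWT(N) for a multiset N given as a list
IsEBWT : ∀ {σ} → List (Str σ) → Str σ → Set
IsEBWT N L = ∃ λ C → (C ↭ concatMap conjugates N) × SortedBy _≺ω_ C × L ≡ map lastSym C

Coll : ℕ → ℕ → Set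
Coll σ m = Fin m → List (Fin σ)

embed : ∀ {σ} → List (Fin σ) → Str σ
embed = map chr

dolStrs : ∀ {σ m} → Coll σ m → List (Str σ)
dolStrs M = tabulate (λ d → embed (M d) ++ (dol ∷ []))

mdolStrs : ∀ {σ m} → Coll σ m → List (Str σ)
mdolStrs U = tabulate (λ d → embed (U d) ++ (sep (suc (toℕ d)) ∷ []))

IsDolEBWT : ∀ {σ m} → Coll σ m → Str σ → Set
IsDolEBWT M L = IsEBWT (dolStrs M) L

IsMdolEBWT : ∀ {σ m} → Coll σ m → Str σ → Set
IsMdolEBWT U L = IsEBWT (mdolStrs U) L

IsMdolBWT : ∀ {σ m} → Coll σ m → Str σ → Set
IsMdolBWT U L = IsBWT (concat (mdolStrs U)) L

IsConcatBWT : ∀ {σ m} → Coll σ m → Str σ → Set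
IsConcatBWT M L = IsBWT (concat (dolStrs M) ++ (hash ∷ [])) L

hashToDol : ∀ {σ} → Sym σ → Sym σ
hashToDol hash = dol
hashToDol x    = x

adapt : ∀ {σ} → Str σ → Str σ
adapt L = map hashToDol (drop 1 L)

IsAdaptedConcatBWT : ∀ {σ m} → Coll σ m → Str σ → Set
IsAdaptedConcatBWT M L = ∃ λ L₀ → IsConcatBWT M L₀ × L ≡ adapt L₀

unsep : ∀ {σ} → Sym σ → Sym σ
unsep (sep _) = dol
unsep x       = x

_≐_ : ∀ {σ} → Str σ → Str σ → Set
L ≐ L' = map unsep L ≡ map unsep L'

-- Each transform lists the symbols cyclically preceding the positions (d , i), i ≤ |T_d|, of the
-- strings, in the order of the conjugates starting there, and up to separators that symbol depends
-- only on the position. Two conjugates compare like their keys T_d[i..] $ unless these suffixes are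
-- equal for distinct strings; such ties are broken by d in mdolEBWT and mdolBWT, by the omega-order
-- of T_d $ in dolEBWT, and by the text following T_d $ in concatBWT. Sorting the strings by that
-- secondary key gives τ for which the lexicographic order of the rotations of
-- T_τ(1) $_1 ⋯ T_τ(m) $_m refines the given order. Two sorted listings of the same positions, one
-- under a refinement of the other's order, differ only among ties, and tied conjugates are equal
-- strings, so their last symbols agree.

module Submission where

open import Defs
open import Data.Nat as ℕ using (ℕ; zero; suc; _+_; _*_; _∸_; z≤n; s≤s)
import Data.Nat.Properties as ℕ
open import Data.Fin as Fin using (Fin; toℕ; punchIn)
import Data.Fin.Properties as Fin
open import Data.Fin.Permutation using (Permutation′; _⟨$⟩ʳ_; _⟨$⟩ˡ_; id; insert; remove; insert-punchIn; insert-remove; inverseˡ)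
open import Data.List using (List; []; _∷_; _++_; [_]; map; concat; concatMap; drop; take; length; tabulate; applyUpTo; upTo)
open import Data.List.Properties using (++-assoc; ++-identityʳ; length-++; length-map; length-drop; drop-drop; take++drop≡id; map-∘; map-cong; map-tabulate; tabulate-cong; concat-map; map-upTo; map-applyUpTo; drop-map; map-injective; map-cong-local; ≡-dec)
open import Data.List.Relation.Unary.All as All using (All; []; _∷_)
import Data.List.Relation.Unary.All.Properties as All
open import Data.List.Relation.Unary.AllPairs using (AllPairs; []; _∷_)
open import Data.List.Relation.Unary.Linked as Linked using (Linked; []; [-]; _∷_)
import Data.List.Relation.Unary.Linked.Properties as Linked
open import Data.List.Relation.Unary.Any using (here; there)
open import Data.List.Membership.Propositional using (_∈_)
open import Data.List.Membership.Propositional.Properties using (∈-∃++; ∈-++⁻; ∈-++⁺ʳ; ∈-map⁻)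
open import Data.List.Relation.Binary.Permutation.Propositional using (_↭_; ↭-refl; ↭-reflexive; ↭-sym; ↭-trans; module PermutationReasoning)
open import Data.List.Relation.Binary.Permutation.Propositional.Properties using (↭-empty-inv; drop-mid; All-resp-↭; ∈-resp-↭; ↭-map-inv; shifts; ++⁺ˡ)
import Data.List.Relation.Binary.Permutation.Propositional.Properties as ↭
open import Data.Product using (∃; _×_; _,_; proj₁; proj₂)
open import Data.Sum using (_⊎_; inj₁; inj₂)
open import Data.Empty using (⊥-elim)
open import Function using (_∘_; _on_)
open import Relation.Nullary using (¬_; yes; no)
open import Relation.Nullary.Decidable using (decidable-stable)
open import Relation.Binary using (Transitive; Trichotomous; tri<; tri≈; tri>; StrictTotalOrder; DecidableEquality)
import Relation.Binary.Properties.StrictTotalOrder as StrictTotalOrderProperties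
import Relation.Binary.Construct.On as On
import Data.List.Sort as Sort
open import Relation.Binary.Consequences using (tri⇒dec≈)
open import Relation.Binary.PropositionalEquality using (_≡_; _≢_; refl; sym; trans; cong; cong₂; subst; subst₂; isEquivalence; resp₂; module ≡-Reasoning)

private
  variable
    σ m : ℕ

-- Orders on symbols and strings

<S-irrefl : {x : Sym σ} → ¬ x <S x
<S-irrefl (s<s i<i) = ℕ.<-irrefl refl i<i
<S-irrefl (c<c a<a) = Fin.<-irrefl refl a<a

<S-trans : Transitive (_<S_ {σ})
<S-trans h<d d<s         = h<s
<S-trans h<d d<c         = h<c
<S-trans h<s (s<s _)     = h<s
<S-trans h<s s<c         = h<c
<S-trans h<c (c<c _)     = h<c
<S-trans d<s (s<s _)     = d<s
<S-trans d<s s<c         = d<c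
<S-trans d<c (c<c _)     = d<c
<S-trans (s<s i<j) (s<s j<k) = s<s (ℕ.<-trans i<j j<k)
<S-trans (s<s _) s<c     = s<c
<S-trans s<c (c<c _)     = s<c
<S-trans (c<c a<b) (c<c b<c) = c<c (Fin.<-trans a<b b<c)

<S-asym : {x y : Sym σ} → x <S y → ¬ y <S x
<S-asym x<y y<x = <S-irrefl (<S-trans x<y y<x)

<S-compare : Trichotomous _≡_ (_<S_ {σ})
<S-compare hash    hash    = tri≈ <S-irrefl refl <S-irrefl
<S-compare hash    dol     = tri< h<d (λ ()) (λ ())
<S-compare hash    (sep _) = tri< h<s (λ ()) (λ ())
<S-compare hash    (chr _) = tri< h<c (λ ()) (λ ())
<S-compare dol     hash    = tri> (λ ()) (λ ()) h<d
<S-compare dol     dol     = tri≈ <S-irrefl refl <S-irrefl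
<S-compare dol     (sep _) = tri< d<s (λ ()) (λ ())
<S-compare dol     (chr _) = tri< d<c (λ ()) (λ ())
<S-compare (sep _) hash    = tri> (λ ()) (λ ()) h<s
<S-compare (sep _) dol     = tri> (λ ()) (λ ()) d<s
<S-compare (sep i) (sep j) with ℕ.<-cmp i j
... | tri< i<j _ _    = tri< (s<s i<j) (λ { refl → ℕ.<-irrefl refl i<j }) (<S-asym (s<s i<j))
... | tri≈ _ refl _   = tri≈ <S-irrefl refl <S-irrefl
... | tri> _ _ j<i    = tri> (<S-asym (s<s j<i)) (λ { refl → ℕ.<-irrefl refl j<i }) (s<s j<i)
<S-compare (sep _) (chr _) = tri< s<c (λ ()) (λ ())
<S-compare (chr _) hash    = tri> (λ ()) (λ ()) h<c
<S-compare (chr _) dol     = tri> (λ ()) (λ ()) d<c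
<S-compare (chr _) (sep _) = tri> (λ ()) (λ ()) s<c
<S-compare (chr a) (chr b) with Fin.<-cmp a b
... | tri< a<b _ _    = tri< (c<c a<b) (λ { refl → Fin.<-irrefl refl a<b }) (<S-asym (c<c a<b))
... | tri≈ _ refl _   = tri≈ <S-irrefl refl <S-irrefl
... | tri> _ _ b<a    = tri> (<S-asym (c<c b<a)) (λ { refl → Fin.<-irrefl refl b<a }) (c<c b<a)

_≟S_ : DecidableEquality (Sym σ)
_≟S_ = tri⇒dec≈ <S-compare

_≟Str_ : DecidableEquality (Str σ)
_≟Str_ = ≡-dec _≟S_

<lex-irrefl : {xs : Str σ} → ¬ xs <lex xs
<lex-irrefl (here x<x)   = <S-irrefl x<x
<lex-irrefl (there p)    = <lex-irrefl p

<lex-trans : Transitive (_<lex_ {σ})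
<lex-trans []<∷      (here _)  = []<∷
<lex-trans []<∷      (there _) = []<∷
<lex-trans (here p)  (here q)  = here (<S-trans p q)
<lex-trans (here p)  (there _) = here p
<lex-trans (there _) (here q)  = here q
<lex-trans (there p) (there q) = there (<lex-trans p q)

<lex-asym : {xs ys : Str σ} → xs <lex ys → ¬ ys <lex xs
<lex-asym p q = <lex-irrefl (<lex-trans p q)

<lex-compare : Trichotomous _≡_ (_<lex_ {σ})
<lex-compare []       []       = tri≈ <lex-irrefl refl <lex-irrefl
<lex-compare []       (_ ∷ _)  = tri< []<∷ (λ ()) (λ ())
<lex-compare (_ ∷ _)  []       = tri> (λ ()) (λ ()) []<∷
<lex-compare (x ∷ xs) (y ∷ ys) with <S-compare x y
... | tri< x<y _ _ = tri< (here x<y) (λ { refl → <S-irrefl x<y }) (<lex-asym (here x<y))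
... | tri> _ _ y<x = tri> (<lex-asym (here y<x)) (λ { refl → <S-irrefl y<x }) (here y<x)
... | tri≈ _ refl _ with <lex-compare xs ys
...   | tri< p _ _    = tri< (there p) (λ { refl → <lex-irrefl p }) (<lex-asym (there p))
...   | tri≈ _ refl _ = tri≈ <lex-irrefl refl <lex-irrefl
...   | tri> _ _ p    = tri> (<lex-asym (there p)) (λ { refl → <lex-irrefl p }) (there p)

<lex-strictTotalOrder : ℕ → StrictTotalOrder _ _ _
<lex-strictTotalOrder σ = record
  { isStrictTotalOrder = record
    { isStrictPartialOrder = record
      { isEquivalence = isEquivalence
      ; irrefl        = λ { refl → <lex-irrefl }
      ; trans         = <lex-trans
      ; <-resp-≈      = resp₂ (_<lex_ {σ})
      }
    ; compare = <lex-compare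
    }
  }

≮lex-trans : {x y z : Str σ} → ¬ y <lex x → ¬ z <lex y → ¬ z <lex x
≮lex-trans {x = x} {y} y≮x z≮y z<x with <lex-compare x y
... | tri< x<y _ _  = z≮y (<lex-trans z<x x<y)
... | tri≈ _ refl _ = z≮y z<x
... | tri> _ _ y<x  = y≮x y<x

≮lex-antisym : {x y : Str σ} → ¬ x <lex y → ¬ y <lex x → x ≡ y
≮lex-antisym {x = x} {y} x≮y y≮x with <lex-compare x y
... | tri< x<y _ _ = ⊥-elim (x≮y x<y)
... | tri≈ _ x≡y _ = x≡y
... | tri> _ _ y<x = ⊥-elim (y≮x y<x)

-- Sorting

module _ {a ℓ₁ ℓ₂} (O : StrictTotalOrder a ℓ₁ ℓ₂) where
  open StrictTotalOrder O renaming (Carrier to A; trans to <-trans)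

  minimum : (key : Fin (suc m) → A) → ∃ λ d → ∀ d′ → ¬ key d′ < key d
  minimum {zero}  key = Fin.zero , λ { Fin.zero → irrefl Eq.refl }
  minimum {suc m} key with minimum (key ∘ Fin.suc)
  ... | c , c-min with compare (key (Fin.suc c)) (key Fin.zero)
  ...   | tri< c<0 _ _ = Fin.suc c , λ { Fin.zero → asym c<0 ; (Fin.suc e) → c-min e }
  ...   | tri≈ _ c≈0 _ = Fin.zero , λ { Fin.zero → irrefl Eq.refl ; (Fin.suc e) e<0 → c-min e (<-respʳ-≈ (Eq.sym c≈0) e<0) }
  ...   | tri> _ _ 0<c = Fin.zero , λ { Fin.zero → irrefl Eq.refl ; (Fin.suc e) e<0 → c-min e (<-trans e<0 0<c) }

  sortingPermutation : (key : Fin m → A) →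
    ∃ λ (τ : Permutation′ m) → ∀ {p q} → key (τ ⟨$⟩ʳ p) < key (τ ⟨$⟩ʳ q) → p Fin.< q
  sortingPermutation {zero}  key = id , λ { {()} }
  sortingPermutation {suc m} key with minimum key
  ... | d , d-min with sortingPermutation (key ∘ punchIn d)
  ...   | τ , τ-sorts = insert Fin.zero d τ , sorts
    where
    τ-suc : ∀ p → insert Fin.zero d τ ⟨$⟩ʳ Fin.suc p ≡ punchIn d (τ ⟨$⟩ʳ p)
    τ-suc = insert-punchIn Fin.zero d τ
    sorts : ∀ {p q} → key (insert Fin.zero d τ ⟨$⟩ʳ p) < key (insert Fin.zero d τ ⟨$⟩ʳ q) → p Fin.< q
    sorts {Fin.zero}  {Fin.zero}  d<d = ⊥-elim (irrefl Eq.refl d<d)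
    sorts {Fin.zero}  {Fin.suc q} _   = s≤s z≤n
    sorts {Fin.suc p} {Fin.zero}  p<d = ⊥-elim (d-min _ p<d)
    sorts {Fin.suc p} {Fin.suc q} p<q rewrite τ-suc p | τ-suc q = s≤s (τ-sorts p<q)

⟨$⟩ʳ-injective : (τ : Permutation′ m) {p q : Fin m} → τ ⟨$⟩ʳ p ≡ τ ⟨$⟩ʳ q → p ≡ q
⟨$⟩ʳ-injective τ {p} {q} τp≡τq = trans (sym (inverseˡ τ)) (trans (cong (τ ⟨$⟩ˡ_) τp≡τq) (inverseˡ τ))

module _ {A : Set} where

  concat-tabulate-punchIn : (G : Fin (suc m) → List A) (d : Fin (suc m)) →
    G d ++ concat (tabulate (G ∘ punchIn d)) ↭ concat (tabulate G)
  concat-tabulate-punchIn G Fin.zero = ↭-refl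
  concat-tabulate-punchIn {suc m} G (Fin.suc d) =
    ↭-trans (shifts (G (Fin.suc d)) (G Fin.zero)) (++⁺ˡ (G Fin.zero) (concat-tabulate-punchIn (G ∘ Fin.suc) d))

  concat-tabulate-↭ : (τ : Permutation′ m) (G : Fin m → List A) →
    concat (tabulate (G ∘ (τ ⟨$⟩ʳ_))) ↭ concat (tabulate G)
  concat-tabulate-↭ {zero}  τ G = ↭-refl
  concat-tabulate-↭ {suc m} τ G = begin
    G d ++ concat (tabulate (G ∘ (τ ⟨$⟩ʳ_) ∘ Fin.suc))    ≡⟨ cong (λ xs → G d ++ concat xs) (tabulate-cong τ-suc) ⟩
    G d ++ concat (tabulate (G ∘ punchIn d ∘ (ρ ⟨$⟩ʳ_)))  ↭⟨ ++⁺ˡ (G d) (concat-tabulate-↭ ρ (G ∘ punchIn d)) ⟩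
    G d ++ concat (tabulate (G ∘ punchIn d))             ↭⟨ concat-tabulate-punchIn G d ⟩
    concat (tabulate G)                                  ∎
    where
    open PermutationReasoning
    d = τ ⟨$⟩ʳ Fin.zero
    ρ = remove Fin.zero τ
    τ-suc : ∀ k → G (τ ⟨$⟩ʳ Fin.suc k) ≡ G (punchIn d (ρ ⟨$⟩ʳ k))
    τ-suc k = cong G (trans (sym (insert-remove Fin.zero τ (Fin.suc k))) (insert-punchIn Fin.zero d ρ k))

Linked-map-All : {A : Set} {P : A → Set} {R S : A → A → Set} → (∀ {x y} → P x → P y → R x y → S x y) →
  ∀ {xs} → All P xs → Linked R xs → Linked S xs
Linked-map-All f []             []        = []
Linked-map-All f (_ ∷ [])       [-]       = [-]
Linked-map-All f (px ∷ py ∷ ps) (r ∷ rs)  = f px py r ∷ Linked-map-All f (py ∷ ps) rs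

module _ {I : Set} {_≺_ : I → I → Set} where

  private
    Sorted : List I → Set
    Sorted = AllPairs (λ x y → ¬ y ≺ x)

    sorted-remove : ∀ B₁ {x B₂} → Sorted (B₁ ++ x ∷ B₂) → Sorted (B₁ ++ B₂) × All (λ c → ¬ x ≺ c) B₁
    sorted-remove []       (_ ∷ sorted)    = sorted , []
    sorted-remove (b ∷ B₁) (b≤ ∷ sorted) with sorted-remove B₁ sorted | All.++⁻ B₁ b≤
    ... | sorted′ , B₁≤x | b≤B₁ , b≤x ∷ b≤B₂ = All.++⁺ b≤B₁ b≤B₂ ∷ sorted′ , b≤x ∷ B₁≤x

  sorted-↭⇒map-≡ : {B : Set} (g : I → B) → (∀ {x y} → ¬ x ≺ y → ¬ y ≺ x → g x ≡ g y) → ∀ {xs ys} → xs ↭ ys →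
    AllPairs (λ x y → ¬ y ≺ x) xs → AllPairs (λ x y → ¬ y ≺ x) ys → map g xs ≡ map g ys
  sorted-↭⇒map-≡ g g-tie {[]} xs↭ys _ _ with ↭-empty-inv (↭-sym xs↭ys)
  ... | refl = refl
  sorted-↭⇒map-≡ g g-tie {x ∷ xs} xs↭ys (x≤xs ∷ xs-sorted) ys-sorted with ∈-∃++ (∈-resp-↭ xs↭ys (here refl))
  ... | B₁ , B₂ , refl with sorted-remove B₁ ys-sorted
  ...   | B₁B₂-sorted , B₁≤x = begin
    g x ∷ map g xs               ≡⟨ cong (g x ∷_) (sorted-↭⇒map-≡ g g-tie xs↭B₁B₂ xs-sorted B₁B₂-sorted) ⟩
    g x ∷ map g (B₁ ++ B₂)        ≡⟨ move B₁ ties ⟩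
    map g (B₁ ++ x ∷ B₂)          ∎
    where
    open ≡-Reasoning
    xs↭B₁B₂ : xs ↭ B₁ ++ B₂
    xs↭B₁B₂ = drop-mid [] B₁ xs↭ys
    ties : All (λ c → g c ≡ g x) B₁
    ties = All.zipWith (λ { (c⊀x , x⊀c) → g-tie c⊀x x⊀c }) (All.++⁻ˡ B₁ (All-resp-↭ xs↭B₁B₂ x≤xs) , B₁≤x)
    move : ∀ C → All (λ c → g c ≡ g x) C → g x ∷ map g (C ++ B₂) ≡ map g (C ++ x ∷ B₂)
    move []      []          = refl
    move (c ∷ C) (c≡x ∷ C≡x) = cong₂ _∷_ (sym c≡x) (trans (cong (_∷ map g (C ++ B₂)) c≡x) (move C C≡x))

-- Mismatches, prefixes and terminators

infix 4 _<ᵐ_ _isPrefixOf_ _◁_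

-- k <ᵐ k′ : k and k′ first differ at a position inside both, and k has the smaller symbol there.
-- Unlike _<lex_, this survives extending either side.
data _<ᵐ_ {σ : ℕ} : Str σ → Str σ → Set where
  here  : ∀ {x y xs ys} → x <S y → (x ∷ xs) <ᵐ (y ∷ ys)
  there : ∀ {x xs ys} → xs <ᵐ ys → (x ∷ xs) <ᵐ (x ∷ ys)

<ᵐ-++ : {xs ys : Str σ} → xs <ᵐ ys → ∀ us vs → (xs ++ us) <ᵐ (ys ++ vs)
<ᵐ-++ (here x<y) us vs = here x<y
<ᵐ-++ (there p)  us vs = there (<ᵐ-++ p us vs)

++-<ᵐ : (ws : Str σ) {xs ys : Str σ} → xs <ᵐ ys → (ws ++ xs) <ᵐ (ws ++ ys)
++-<ᵐ []       p = p
++-<ᵐ (w ∷ ws) p = there (++-<ᵐ ws p)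

<ᵐ⇒<lex : {xs ys : Str σ} → xs <ᵐ ys → xs <lex ys
<ᵐ⇒<lex (here x<y) = here x<y
<ᵐ⇒<lex (there p)  = there (<ᵐ⇒<lex p)

_isPrefixOf_ : Str σ → Str σ → Set
k isPrefixOf S = ∃ λ r → S ≡ k ++ r

isPrefixOf-refl : (k : Str σ) → k isPrefixOf k
isPrefixOf-refl k = [] , sym (++-identityʳ k)

<ᵐ-prefixes⇒<lex : {k k′ S T : Str σ} → k <ᵐ k′ → k isPrefixOf S → k′ isPrefixOf T → S <lex T
<ᵐ-prefixes⇒<lex k<k′ (r , refl) (r′ , refl) = <ᵐ⇒<lex (<ᵐ-++ k<k′ r r′)

-- u ◁ v : u is below v whatever terminates them, as long as the terminator of u is below every
-- symbol of v; this also covers u being a proper prefix of v.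
_◁_ : Str σ → Str σ → Set
u ◁ v = ∀ {s} t → All (s <S_) v → (u ++ [ s ]) <ᵐ (v ++ [ t ])

compare-words : (u v : Str σ) → u ◁ v ⊎ u ≡ v ⊎ v ◁ u
compare-words []      []      = inj₂ (inj₁ refl)
compare-words []      (y ∷ v) = inj₁ λ { _ (s<y ∷ _) → here s<y }
compare-words (x ∷ u) []      = inj₂ (inj₂ λ { _ (s<x ∷ _) → here s<x })
compare-words (x ∷ u) (y ∷ v) with <S-compare x y
... | tri< x<y _ _ = inj₁ λ _ _ → here x<y
... | tri> _ _ y<x = inj₂ (inj₂ λ _ _ → here y<x)
... | tri≈ _ refl _ with compare-words u v
...   | inj₁ u◁v        = inj₁ λ { t (_ ∷ below) → there (u◁v t below) }
...   | inj₂ (inj₁ refl) = inj₂ (inj₁ refl)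
...   | inj₂ (inj₂ v◁u) = inj₂ (inj₂ λ { t (_ ∷ below) → there (v◁u t below) })

data Terminator {σ : ℕ} : Sym σ → Set where
  hash : Terminator hash
  dol  : Terminator dol
  sep  : ∀ j → Terminator (sep j)

Terminator⇒<chr : ∀ {s} {c : Fin σ} → Terminator s → s <S chr c
Terminator⇒<chr hash    = h<c
Terminator⇒<chr dol     = d<c
Terminator⇒<chr (sep _) = s<c

Terminator⇒below-embed : ∀ {s} → Terminator s → (w : List (Fin σ)) → All (s <S_) (embed w)
Terminator⇒below-embed t w = All.map⁺ (All.universal (λ _ → Terminator⇒<chr t) w)

-- The omega-order

-- S <ω-lex T unfolds to omega S <ˢ omega T, so the lemmas on sequences apply to strings.
Seq : ℕ → Set
Seq σ = ℕ → Sym σ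

_<ˢ_ : Seq σ → Seq σ → Set
s <ˢ t = ∃ λ k → (∀ j → j ℕ.< k → s j ≡ t j) × s k <S t k

<ˢ-irrefl : {s : Seq σ} → ¬ s <ˢ s
<ˢ-irrefl (_ , _ , sk<sk) = <S-irrefl sk<sk

<ˢ-trans : {s t u : Seq σ} → s <ˢ t → t <ˢ u → s <ˢ u
<ˢ-trans {s = s} {t} {u} (k , s≡t , sk<tk) (l , t≡u , tl<ul) with ℕ.<-cmp k l
... | tri< k<l _ _  = k , (λ j j<k → trans (s≡t j j<k) (t≡u j (ℕ.<-trans j<k k<l))) , subst (s k <S_) (t≡u k k<l) sk<tk
... | tri≈ _ refl _ = k , (λ j j<k → trans (s≡t j j<k) (t≡u j j<k)) , <S-trans sk<tk tl<ul
... | tri> _ _ l<k  = l , (λ j j<l → trans (s≡t j (ℕ.<-trans j<l l<k)) (t≡u j j<l)) , subst (_<S u l) (sym (s≡t l l<k)) tl<ul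

<ˢ-asym : {s t : Seq σ} → s <ˢ t → ¬ t <ˢ s
<ˢ-asym s<t t<s = <ˢ-irrefl (<ˢ-trans s<t t<s)

<ˢ-respʳ : {s t t′ : Seq σ} → (∀ i → t i ≡ t′ i) → s <ˢ t → s <ˢ t′
<ˢ-respʳ {s = s} t≡t′ (k , s≡t , sk<tk) = k , (λ j j<k → trans (s≡t j j<k) (t≡t′ j)) , subst (s k <S_) (t≡t′ k) sk<tk

-- Finding the first difference of two infinite sequences is not constructive, hence ¬ ¬.
<ˢ-¬¬compare : (s t : Seq σ) → ¬ ¬ (s <ˢ t ⊎ (∀ i → s i ≡ t i) ⊎ t <ˢ s)
<ˢ-¬¬compare s t ¬cmp = ¬cmp (inj₂ (inj₁ λ i → agree-below (suc i) i ℕ.≤-refl))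
  where
  agree-below : ∀ k j → j ℕ.< k → s j ≡ t j
  agree-below (suc k) j j<1+k with <S-compare (s k) (t k)
  ... | tri< sk<tk _ _ = ⊥-elim (¬cmp (inj₁ (k , agree-below k , sk<tk)))
  ... | tri> _ _ tk<sk = ⊥-elim (¬cmp (inj₂ (inj₂ (k , (λ i i<k → sym (agree-below k i i<k)) , tk<sk))))
  ... | tri≈ _ sk≡tk _ with ℕ.m≤n⇒m<n∨m≡n (ℕ.≤-pred j<1+k)
  ...   | inj₁ j<k  = agree-below k j j<k
  ...   | inj₂ refl = sk≡tk

at-++ˡ : (xs ys : Str σ) {j : ℕ} → j ℕ.< length xs → at (xs ++ ys) j ≡ at xs j
at-++ˡ (x ∷ xs) ys {zero}  _         = refl
at-++ˡ (x ∷ xs) ys {suc j} (s≤s j<n) = at-++ˡ xs ys j<n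

at-++ʳ : (xs ys : Str σ) (j : ℕ) → at (xs ++ ys) (length xs + j) ≡ at ys j
at-++ʳ []       ys j = refl
at-++ʳ (x ∷ xs) ys j = at-++ʳ xs ys j

at-ext : (xs ys : Str σ) → length xs ≡ length ys → (∀ j → j ℕ.< length xs → at xs j ≡ at ys j) → xs ≡ ys
at-ext []       []       _     _     = refl
at-ext (x ∷ xs) (y ∷ ys) |xs|≡ at≡ =
  cong₂ _∷_ (at≡ 0 (s≤s z≤n)) (at-ext xs ys (ℕ.suc-injective |xs|≡) (λ j j<n → at≡ (suc j) (s≤s j<n)))

pow-+ : (S : Str σ) (a b : ℕ) → pow S (a + b) ≡ pow S a ++ pow S b
pow-+ S zero    b = refl
pow-+ S (suc a) b = trans (cong (S ++_) (pow-+ S a b)) (sym (++-assoc S (pow S a) (pow S b)))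

length-pow : (S : Str σ) (a : ℕ) → length (pow S a) ≡ a * length S
length-pow S zero    = refl
length-pow S (suc a) = trans (length-++ S) (cong (length S +_) (length-pow S a))

<⇒<*pos : {j K n : ℕ} → j ℕ.< K → 0 ℕ.< n → j ℕ.< K * n
<⇒<*pos {K = K} {n} j<K 0<n = ℕ.<-≤-trans j<K (ℕ.m≤m*n K n {{ℕ.>-nonZero 0<n}})

at-pow : (S Y : Str σ) {a b j : ℕ} → a ℕ.≤ b → j ℕ.< a * length S → at (pow S b ++ Y) j ≡ at (pow S a) j
at-pow S Y {a} {b} {j} a≤b j<aS = begin
  at (pow S b ++ Y) j                          ≡⟨ cong (λ n → at (pow S n ++ Y) j) (sym (ℕ.m+[n∸m]≡n a≤b)) ⟩
  at (pow S (a + (b ∸ a)) ++ Y) j              ≡⟨ cong (λ P → at (P ++ Y) j) (pow-+ S a (b ∸ a)) ⟩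
  at ((pow S a ++ pow S (b ∸ a)) ++ Y) j       ≡⟨ cong (λ P → at P j) (++-assoc (pow S a) _ Y) ⟩
  at (pow S a ++ (pow S (b ∸ a) ++ Y)) j       ≡⟨ at-++ˡ (pow S a) _ (subst (j ℕ.<_) (sym (length-pow S a)) j<aS) ⟩
  at (pow S a) j                               ∎
  where open ≡-Reasoning

omega-pow : (S Y : Str σ) {K j : ℕ} → j ℕ.< K * length S → omega S j ≡ at (pow S K ++ Y) j
omega-pow S Y {K} {j} j<KS with ℕ.≤-total K (suc j)
... | inj₁ K≤1+j = begin
  at (pow S (suc j)) j        ≡⟨ cong (λ P → at P j) (++-identityʳ (pow S (suc j))) ⟨
  at (pow S (suc j) ++ []) j  ≡⟨ at-pow S [] K≤1+j j<KS ⟩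
  at (pow S K) j              ≡⟨ at-pow S Y {K} ℕ.≤-refl j<KS ⟨
  at (pow S K ++ Y) j         ∎
  where open ≡-Reasoning
... | inj₂ 1+j≤K = sym (at-pow S Y 1+j≤K j<[1+j]S)
  where
  j<[1+j]S : j ℕ.< suc j * length S
  j<[1+j]S = <⇒<*pos (ℕ.n<1+n j) (positive (length S) {K = K} j<KS)
    where
    positive : ∀ n {j K} → j ℕ.< K * n → 0 ℕ.< n
    positive zero    {j} {K} j<K*0 = ⊥-elim (ℕ.n≮0 (subst (j ℕ.<_) (ℕ.*-zeroʳ K) j<K*0))
    positive (suc n) _             = s≤s z≤n

omega-at : (S : Str σ) {j : ℕ} → j ℕ.< length S → omega S j ≡ at S j
omega-at S {j} = at-++ˡ S (pow S j)

omega-prefix : {k S : Str σ} → k isPrefixOf S → {j : ℕ} → j ℕ.< length k → omega S j ≡ at k j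
omega-prefix {k = k} (r , refl) j<k =
  trans (omega-at (k ++ r) (ℕ.<-≤-trans j<k (subst (length k ℕ.≤_) (sym (length-++ k)) (ℕ.m≤m+n _ _)))) (at-++ˡ k r j<k)

<ᵐ-first-difference : {k k′ : Str σ} → k <ᵐ k′ →
  ∃ λ j → j ℕ.< length k × j ℕ.< length k′ × (∀ i → i ℕ.< j → at k i ≡ at k′ i) × at k j <S at k′ j
<ᵐ-first-difference (here x<y) = 0 , s≤s z≤n , s≤s z≤n , (λ _ ()) , x<y
<ᵐ-first-difference (there p) with <ᵐ-first-difference p
... | j , j<k , j<k′ , agree , differ =
  suc j , s≤s j<k , s≤s j<k′ , (λ { zero _ → refl ; (suc i) (s≤s i<j) → agree i i<j }) , differ

<ᵐ-prefixes⇒<ω-lex : {k k′ S T : Str σ} → k <ᵐ k′ → k isPrefixOf S → k′ isPrefixOf T → S <ω-lex T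
<ᵐ-prefixes⇒<ω-lex k<k′ kS k′T with <ᵐ-first-difference k<k′
... | j , j<k , j<k′ , agree , differ =
  j , (λ i i<j → trans (omega-prefix kS (ℕ.<-trans i<j j<k)) (trans (agree i i<j) (sym (omega-prefix k′T (ℕ.<-trans i<j j<k′))))) ,
  subst₂ _<S_ (sym (omega-prefix kS j<k)) (sym (omega-prefix k′T j<k′)) differ

rotate-pow : (u v : Str σ) (n : ℕ) → v ++ pow (u ++ v) n ≡ pow (v ++ u) n ++ v
rotate-pow u v zero    = ++-identityʳ v
rotate-pow u v (suc n) = begin
  v ++ ((u ++ v) ++ pow (u ++ v) n)   ≡⟨ cong (v ++_) (++-assoc u v _) ⟩
  v ++ (u ++ (v ++ pow (u ++ v) n))   ≡⟨ cong (λ w → v ++ (u ++ w)) (rotate-pow u v n) ⟩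
  v ++ (u ++ (pow (v ++ u) n ++ v))   ≡⟨ sym (++-assoc v u _) ⟩
  (v ++ u) ++ (pow (v ++ u) n ++ v)   ≡⟨ sym (++-assoc (v ++ u) _ v) ⟩
  ((v ++ u) ++ pow (v ++ u) n) ++ v   ∎
  where open ≡-Reasoning

omega-rotate : (u v : Str σ) (j : ℕ) → 0 ℕ.< length (v ++ u) → omega (u ++ v) (length u + j) ≡ omega (v ++ u) j
omega-rotate u v j 0<|vu| = begin
  omega (u ++ v) (length u + j)
    ≡⟨ omega-pow (u ++ v) [] {suc K} (<⇒<*pos (ℕ.<-trans (ℕ.n<1+n _) (ℕ.n<1+n _)) 0<|uv|) ⟩
  at (pow (u ++ v) (suc K) ++ []) (length u + j)
    ≡⟨ cong (λ w → at w (length u + j)) unfold ⟩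
  at (u ++ (pow (v ++ u) K ++ v)) (length u + j)
    ≡⟨ at-++ʳ u _ j ⟩
  at (pow (v ++ u) K ++ v) j
    ≡⟨ omega-pow (v ++ u) v {K} (<⇒<*pos (s≤s (ℕ.m≤n+m j (length u))) 0<|vu|) ⟨
  omega (v ++ u) j
    ∎
  where
  open ≡-Reasoning
  K = suc (length u + j)
  0<|uv| : 0 ℕ.< length (u ++ v)
  0<|uv| = subst (0 ℕ.<_) (trans (length-++ v) (trans (ℕ.+-comm (length v) _) (sym (length-++ u)))) 0<|vu|
  unfold : pow (u ++ v) (suc K) ++ [] ≡ u ++ (pow (v ++ u) K ++ v)
  unfold = trans (++-identityʳ _) (trans (++-assoc u v _) (cong (u ++_) (rotate-pow u v K)))

<ω-lex-rotate : (u v w : Str σ) → 0 ℕ.< length (v ++ u) → 0 ℕ.< length (w ++ u) →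
  (u ++ v) <ω-lex (u ++ w) → (v ++ u) <ω-lex (w ++ u)
<ω-lex-rotate u v w 0<|vu| 0<|wu| (k , agree , differ) with k ℕ.<? length u
... | yes k<u = ⊥-elim (<S-irrefl (subst₂ _<S_ (omega-prefix {k = u} (v , refl) k<u) (omega-prefix {k = u} (w , refl) k<u) differ))
... | no k≮u =
  k′ , agree′ , subst₂ _<S_ (shift v 0<|vu|) (shift w 0<|wu|) differ
  where
  k′ = k ∸ length u
  u+k′≡k : length u + k′ ≡ k
  u+k′≡k = ℕ.m+[n∸m]≡n (ℕ.≮⇒≥ k≮u)
  shift : ∀ x → 0 ℕ.< length (x ++ u) → omega (u ++ x) k ≡ omega (x ++ u) k′
  shift x 0<|xu| = trans (cong (omega (u ++ x)) (sym u+k′≡k)) (omega-rotate u x k′ 0<|xu|)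
  agree′ : ∀ j → j ℕ.< k′ → omega (v ++ u) j ≡ omega (w ++ u) j
  agree′ j j<k′ = begin
    omega (v ++ u) j               ≡⟨ omega-rotate u v j 0<|vu| ⟨
    omega (u ++ v) (length u + j)  ≡⟨ agree _ (subst (length u + j ℕ.<_) u+k′≡k (ℕ.+-monoʳ-< (length u) j<k′)) ⟩
    omega (u ++ w) (length u + j)  ≡⟨ omega-rotate u w j 0<|wu| ⟩
    omega (w ++ u) j               ∎
    where open ≡-Reasoning

terminatorCount : Str σ → ℕ
terminatorCount []           = 0
terminatorCount (chr _ ∷ xs) = terminatorCount xs
terminatorCount (_ ∷ xs)     = suc (terminatorCount xs)

SingleTerminator : Str σ → Set
SingleTerminator S = terminatorCount S ≡ 1

terminatorCount-++ : (xs ys : Str σ) → terminatorCount (xs ++ ys) ≡ terminatorCount xs + terminatorCount ys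
terminatorCount-++ []            ys = refl
terminatorCount-++ (hash  ∷ xs)  ys = cong suc (terminatorCount-++ xs ys)
terminatorCount-++ (dol   ∷ xs)  ys = cong suc (terminatorCount-++ xs ys)
terminatorCount-++ (sep _ ∷ xs)  ys = cong suc (terminatorCount-++ xs ys)
terminatorCount-++ (chr _ ∷ xs)  ys = terminatorCount-++ xs ys

terminatorCount-pow : (S : Str σ) (a : ℕ) → terminatorCount (pow S a) ≡ a * terminatorCount S
terminatorCount-pow S zero    = refl
terminatorCount-pow S (suc a) = trans (terminatorCount-++ S (pow S a)) (cong (terminatorCount S +_) (terminatorCount-pow S a))

terminatorCount-rot : (i : ℕ) (S : Str σ) → terminatorCount (rot i S) ≡ terminatorCount S
terminatorCount-rot i S = begin
  terminatorCount (drop i S ++ take i S)                 ≡⟨ terminatorCount-++ (drop i S) (take i S) ⟩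
  terminatorCount (drop i S) + terminatorCount (take i S) ≡⟨ ℕ.+-comm (terminatorCount (drop i S)) _ ⟩
  terminatorCount (take i S) + terminatorCount (drop i S) ≡⟨ sym (terminatorCount-++ (take i S) (drop i S)) ⟩
  terminatorCount (take i S ++ drop i S)                 ≡⟨ cong terminatorCount (take++drop≡id i S) ⟩
  terminatorCount S                                      ∎
  where open ≡-Reasoning

terminated-single : ∀ {s} → Terminator s → (w : List (Fin σ)) → SingleTerminator (embed w ++ [ s ])
terminated-single {s = s} t w = trans (terminatorCount-++ (embed w) [ s ]) (cong₂ _+_ (embed-count w) (single t))
  where
  embed-count : (w : List (Fin σ)) → terminatorCount (embed w) ≡ 0
  embed-count []      = refl
  embed-count (_ ∷ w) = embed-count w
  single : ∀ {s} → Terminator s → terminatorCount [ s ] ≡ 1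
  single hash    = refl
  single dol     = refl
  single (sep _) = refl

single-exp : {S : Str σ} {a : ℕ} → SingleTerminator S → IsExp S a → a ≡ 1
single-exp {a = a} one (U , _ , refl) = ℕ.m*n≡1⇒m≡1 a _ (trans (sym (terminatorCount-pow U a)) one)

-- A string with a single terminator is primitive, so the exponent clause of _≺ω_ never applies.
≺ω⇒<ω-lex : {S T : Str σ} → SingleTerminator S → SingleTerminator T → S ≺ω T → S <ω-lex T
≺ω⇒<ω-lex _   _   (inj₁ S<T) = S<T
≺ω⇒<ω-lex one₁ one₂ (inj₂ (_ , a , b , exp-a , exp-b , a<b)) =
  ⊥-elim (ℕ.<-irrefl (trans (single-exp one₁ exp-a) (sym (single-exp one₂ exp-b))) a<b)

≺ω-asym : {S T : Str σ} → SingleTerminator S → SingleTerminator T → S ≺ω T → ¬ T ≺ω S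
≺ω-asym one₁ one₂ S≺T T≺S = <ˢ-asym (≺ω⇒<ω-lex one₁ one₂ S≺T) (≺ω⇒<ω-lex one₂ one₁ T≺S)

-- S ^ |T| and T ^ |S| are the same prefix of S^ω = T^ω; counting terminators gives |S| = |T|.
=ω⇒≡ : {S T : Str σ} → SingleTerminator S → SingleTerminator T → S =ω T → S ≡ T
=ω⇒≡ {S = S} {T} one₁ one₂ S=T =
  at-ext S T |S|≡|T| λ j j<S → trans (sym (omega-at S j<S)) (trans (S=T j) (omega-at T (subst (j ℕ.<_) |S|≡|T| j<S)))
  where
  open ≡-Reasoning
  at-pow-omega : ∀ (U : Str σ) n {j} → j ℕ.< n * length U → at (pow U n) j ≡ omega U j
  at-pow-omega U n j< = sym (trans (omega-pow U [] {n} j<) (cong (λ P → at P _) (++-identityʳ (pow U n))))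
  S^|T|≡T^|S| : pow S (length T) ≡ pow T (length S)
  S^|T|≡T^|S| = at-ext _ _
    (trans (length-pow S (length T)) (trans (ℕ.*-comm (length T) (length S)) (sym (length-pow T (length S)))))
    λ j j< → let j<TS = subst (j ℕ.<_) (length-pow S (length T)) j< in
      trans (at-pow-omega S (length T) j<TS)
        (trans (S=T j) (sym (at-pow-omega T (length S) (subst (j ℕ.<_) (ℕ.*-comm (length T) (length S)) j<TS))))
  |S|≡|T| : length S ≡ length T
  |S|≡|T| = begin
    length S                                   ≡⟨ sym (ℕ.*-identityʳ (length S)) ⟩
    length S * 1                               ≡⟨ cong (length S *_) (sym one₂) ⟩
    length S * terminatorCount T               ≡⟨ sym (terminatorCount-pow T (length S)) ⟩
    terminatorCount (pow T (length S))          ≡⟨ cong terminatorCount (sym S^|T|≡T^|S|) ⟩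
    terminatorCount (pow S (length T))          ≡⟨ terminatorCount-pow S (length T) ⟩
    length T * terminatorCount S               ≡⟨ cong (length T *_) one₁ ⟩
    length T * 1                               ≡⟨ ℕ.*-identityʳ (length T) ⟩
    length T                                   ∎

≮ω-trans : {S T U : Str σ} → SingleTerminator S → SingleTerminator T → SingleTerminator U →
  ¬ T ≺ω S → ¬ U ≺ω T → ¬ U ≺ω S
≮ω-trans {S = S} {T} one₁ one₂ one₃ T⊀S U⊀T U≺S = <ˢ-¬¬compare (omega S) (omega T) λ
  { (inj₁ S<T)         → U⊀T (inj₁ (<ˢ-trans (≺ω⇒<ω-lex one₃ one₁ U≺S) S<T))
  ; (inj₂ (inj₁ S=T))  → U⊀T (inj₁ (<ˢ-respʳ S=T (≺ω⇒<ω-lex one₃ one₁ U≺S)))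
  ; (inj₂ (inj₂ T<S))  → T⊀S (inj₁ T<S) }

≮ω-antisym : {S T : Str σ} → SingleTerminator S → SingleTerminator T → ¬ S ≺ω T → ¬ T ≺ω S → S ≡ T
≮ω-antisym {S = S} {T} one₁ one₂ S⊀T T⊀S = decidable-stable (S ≟Str T) λ S≢T → <ˢ-¬¬compare (omega S) (omega T) λ
  { (inj₁ S<T)        → S⊀T (inj₁ S<T)
  ; (inj₂ (inj₁ S=T)) → S≢T (=ω⇒≡ one₁ one₂ S=T)
  ; (inj₂ (inj₂ T<S)) → T⊀S (inj₁ T<S) }

-- Positions, conjugates and rotations of a concatenation

Pos : ℕ → Set
Pos m = Fin m × ℕ

positions : (Fin m → ℕ) → List (Pos m)
positions ℓ = concat (tabulate λ d → applyUpTo (d ,_) (ℓ d))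

module _ {A : Set} where

  map-positions : (ℓ : Fin m → ℕ) (f : Pos m → A) →
    map f (positions ℓ) ≡ concat (tabulate λ d → applyUpTo (λ i → f (d , i)) (ℓ d))
  map-positions ℓ f = begin
    map f (concat (tabulate G))            ≡⟨ concat-map (tabulate G) ⟨
    concat (map (map f) (tabulate G))      ≡⟨ cong concat (map-tabulate G (map f)) ⟩
    concat (tabulate (map f ∘ G))          ≡⟨ cong concat (tabulate-cong λ d → map-applyUpTo (d ,_) f (ℓ d)) ⟩
    concat (tabulate λ d → applyUpTo (λ i → f (d , i)) (ℓ d)) ∎
    where
    open ≡-Reasoning
    G = λ d → applyUpTo (d ,_) (ℓ d)

  applyUpTo-+ : (f : ℕ → A) (a b : ℕ) → applyUpTo f (a + b) ≡ applyUpTo f a ++ applyUpTo (f ∘ (a +_)) b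
  applyUpTo-+ f zero    b = refl
  applyUpTo-+ f (suc a) b = cong (f 0 ∷_) (applyUpTo-+ (f ∘ suc) a b)

positions-valid : (ℓ : Fin m → ℕ) → All (λ a → proj₂ a ℕ.< ℓ (proj₁ a)) (positions ℓ)
positions-valid ℓ = All.concat⁺ (All.tabulate⁺ λ d → All.applyUpTo⁺₁ _ (ℓ d) (λ i<ℓ → i<ℓ))

reindex : Permutation′ m → Pos m → Pos m
reindex τ (p , i) = τ ⟨$⟩ʳ p , i

positions-↭ : (ℓ : Fin m → ℕ) (τ : Permutation′ m) → positions ℓ ↭ map (reindex τ) (positions (ℓ ∘ (τ ⟨$⟩ʳ_)))
positions-↭ ℓ τ = ↭-sym (subst (_↭ positions ℓ) (sym (map-positions (ℓ ∘ (τ ⟨$⟩ʳ_)) (reindex τ)))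
                                (concat-tabulate-↭ τ λ d → applyUpTo (d ,_) (ℓ d)))

offset : {A : Set} → (Fin m → List A) → Fin m → ℕ
offset G Fin.zero    = 0
offset G (Fin.suc d) = length (G Fin.zero) + offset (G ∘ Fin.suc) d

end : {A : Set} → (Fin m → List A) → Fin m → ℕ
end G d = offset G d + length (G d)

applyUpTo-concat : {A B : Set} (G : Fin m → List A) (h : ℕ → B) →
  applyUpTo h (length (concat (tabulate G))) ≡ map (λ a → h (offset G (proj₁ a) + proj₂ a)) (positions (length ∘ G))
applyUpTo-concat {zero}  G h = refl
applyUpTo-concat {suc m} G h = begin
  applyUpTo h (length (G₀ ++ concat (tabulate G′)))
    ≡⟨ cong (applyUpTo h) (length-++ G₀) ⟩
  applyUpTo h (length G₀ + length (concat (tabulate G′)))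
    ≡⟨ applyUpTo-+ h (length G₀) _ ⟩
  applyUpTo h (length G₀) ++ applyUpTo (h ∘ (length G₀ +_)) (length (concat (tabulate G′)))
    ≡⟨ cong (applyUpTo h (length G₀) ++_) (applyUpTo-concat G′ (h ∘ (length G₀ +_))) ⟩
  applyUpTo h (length G₀) ++ map (λ a → h (length G₀ + (offset G′ (proj₁ a) + proj₂ a))) (positions (length ∘ G′))
    ≡⟨ cong (applyUpTo h (length G₀) ++_) (map-cong (λ a → cong h (sym (ℕ.+-assoc (length G₀) _ _))) _) ⟩
  applyUpTo h (length G₀) ++ map (λ a → h (offset G (Fin.suc (proj₁ a)) + proj₂ a)) (positions (length ∘ G′))
    ≡⟨ cong (applyUpTo h (length G₀) ++_) (map-positions (length ∘ G′) _) ⟩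
  concat (tabulate λ d → applyUpTo (λ i → h (offset G d + i)) (length (G d)))
    ≡⟨ sym (map-positions (length ∘ G) _) ⟩
  map (λ a → h (offset G (proj₁ a) + proj₂ a)) (positions (length ∘ G))
    ∎
  where
  open ≡-Reasoning
  G₀ = G Fin.zero
  G′ = G ∘ Fin.suc

module _ {A : Set} where

  drop-++ˡ : (i : ℕ) (xs ys : List A) → i ℕ.≤ length xs → drop i (xs ++ ys) ≡ drop i xs ++ ys
  drop-++ˡ zero    xs       ys _         = refl
  drop-++ˡ (suc i) (x ∷ xs) ys (s≤s i≤n) = drop-++ˡ i xs ys i≤n

  drop-++ʳ : (xs ys : List A) (n : ℕ) → drop (length xs + n) (xs ++ ys) ≡ drop n ys
  drop-++ʳ []       ys n = refl
  drop-++ʳ (x ∷ xs) ys n = drop-++ʳ xs ys n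

  drop-length-++ : (xs ys : List A) → drop (length xs) (xs ++ ys) ≡ ys
  drop-length-++ []       ys = refl
  drop-length-++ (x ∷ xs) ys = drop-length-++ xs ys

  drop-injective : {i j : ℕ} (xs : List A) → i ℕ.≤ length xs → j ℕ.≤ length xs → drop i xs ≡ drop j xs → i ≡ j
  drop-injective {i} {j} xs i≤ j≤ eq = ℕ.∸-cancelˡ-≡ i≤ j≤ (trans (sym (length-drop i xs)) (trans (cong length eq) (length-drop j xs)))

  concat-tabulate-split : (G : Fin m → List A) (E : List A) (d : Fin m) →
    ∃ λ P → ∃ λ Q → concat (tabulate G) ++ E ≡ P ++ (G d ++ Q) × length P ≡ offset G d
  concat-tabulate-split G E Fin.zero = [] , _ , ++-assoc (G Fin.zero) _ E , refl
  concat-tabulate-split {suc m} G E (Fin.suc d) with concat-tabulate-split (G ∘ Fin.suc) E d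
  ... | P , Q , eq , |P| = G Fin.zero ++ P , Q , split , trans (length-++ (G Fin.zero)) (cong (length (G Fin.zero) +_) |P|)
    where
    open ≡-Reasoning
    split : (G Fin.zero ++ concat (tabulate (G ∘ Fin.suc))) ++ E ≡ (G Fin.zero ++ P) ++ (G (Fin.suc d) ++ Q)
    split = begin
      (G Fin.zero ++ concat (tabulate (G ∘ Fin.suc))) ++ E  ≡⟨ ++-assoc (G Fin.zero) _ E ⟩
      G Fin.zero ++ (concat (tabulate (G ∘ Fin.suc)) ++ E)  ≡⟨ cong (G Fin.zero ++_) eq ⟩
      G Fin.zero ++ (P ++ (G (Fin.suc d) ++ Q))             ≡⟨ sym (++-assoc (G Fin.zero) P _) ⟩
      (G Fin.zero ++ P) ++ (G (Fin.suc d) ++ Q)             ∎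

  offset-suc : (G : Fin (suc m) → List A) (d : Fin m) → offset G (Fin.suc d) ≡ end G (Fin.inject₁ d)
  offset-suc G Fin.zero = ℕ.+-identityʳ (length (G Fin.zero))
  offset-suc {suc m} G (Fin.suc d) =
    trans (cong (length (G Fin.zero) +_) (offset-suc (G ∘ Fin.suc) d)) (sym (ℕ.+-assoc (length (G Fin.zero)) _ _))

  end-≤-offset : (G : Fin m → List A) {d e : Fin m} → d Fin.< e → end G d ℕ.≤ offset G e
  end-≤-offset G {Fin.zero}  {Fin.suc e} _         = ℕ.m≤m+n _ _
  end-≤-offset G {Fin.suc d} {Fin.suc e} (s≤s d<e) =
    subst (ℕ._≤ offset G (Fin.suc e)) (sym (ℕ.+-assoc (length (G Fin.zero)) _ _)) (ℕ.+-monoʳ-≤ _ (end-≤-offset (G ∘ Fin.suc) d<e))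

  end-injective : (G : Fin m → List A) → (∀ d → 0 ℕ.< length (G d)) → {d e : Fin m} → end G d ≡ end G e → d ≡ e
  end-injective G nonempty {d} {e} end≡ with Fin.<-cmp d e
  ... | tri< d<e _ _ = ⊥-elim (ℕ.<-irrefl end≡ (end-< d<e))
    where
    end-< : ∀ {d e} → d Fin.< e → end G d ℕ.< end G e
    end-< {d} {e} d<e = ℕ.≤-<-trans (end-≤-offset G d<e) (ℕ.m<m+n (offset G e) (nonempty e))
  ... | tri≈ _ d≡e _ = d≡e
  ... | tri> _ _ e<d = ⊥-elim (ℕ.<-irrefl (sym end≡) (ℕ.≤-<-trans (end-≤-offset G e<d) (ℕ.m<m+n (offset G d) (nonempty d))))

  end-≤-length : (G : Fin m → List A) (d : Fin m) → end G d ℕ.≤ length (concat (tabulate G))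
  end-≤-length G d with concat-tabulate-split G [] d
  ... | P , Q , W≡ , |P|≡ = begin
    offset G d + length (G d)                ≡⟨ cong (_+ length (G d)) |P|≡ ⟨
    length P + length (G d)                  ≤⟨ ℕ.+-monoʳ-≤ (length P) (ℕ.m≤m+n _ _) ⟩
    length P + (length (G d) + length Q)     ≡⟨ trans (length-++ P) (cong (length P +_) (length-++ (G d))) ⟨
    length (P ++ (G d ++ Q))                 ≡⟨ cong length W≡ ⟨
    length (concat (tabulate G) ++ [])       ≡⟨ cong length (++-identityʳ (concat (tabulate G))) ⟩
    length (concat (tabulate G))             ∎
    where open ℕ.≤-Reasoning

after : (G : Fin m → Str σ) (E : Str σ) → Fin m → Str σ
after G E d = drop (end G d) (concat (tabulate G) ++ E)

drop-offset : (G : Fin m → Str σ) (E : Str σ) (d : Fin m) →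
  drop (offset G d) (concat (tabulate G) ++ E) ≡ G d ++ after G E d
drop-offset G E d with concat-tabulate-split G E d
... | P , Q , W≡ , |P|≡ = begin
  drop (offset G d) (concat (tabulate G) ++ E) ≡⟨ cong₂ drop (sym |P|≡) W≡ ⟩
  drop (length P) (P ++ (G d ++ Q))            ≡⟨ drop-length-++ P _ ⟩
  G d ++ Q                                     ≡⟨ cong (G d ++_) after≡Q ⟨
  G d ++ after G E d                           ∎
  where
  open ≡-Reasoning
  after≡Q : after G E d ≡ Q
  after≡Q = begin
    drop (offset G d + length (G d)) (concat (tabulate G) ++ E) ≡⟨ cong₂ (λ n → drop (n + length (G d))) (sym |P|≡) W≡ ⟩
    drop (length P + length (G d)) (P ++ (G d ++ Q))            ≡⟨ drop-++ʳ P _ (length (G d)) ⟩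
    drop (length (G d)) (G d ++ Q)                              ≡⟨ drop-length-++ (G d) Q ⟩
    Q                                                           ∎

conjugateOf : (Fin m → Str σ) → Pos m → Str σ
conjugateOf G (d , i) = rot i (G d)

rotationOf : (Fin m → Str σ) → Str σ → Pos m → Str σ
rotationOf G E (d , i) = rot (offset G d + i) (concat (tabulate G) ++ E)

concatMap-conjugates : (G : Fin m → Str σ) → concatMap conjugates (tabulate G) ≡ map (conjugateOf G) (positions (length ∘ G))
concatMap-conjugates G = begin
  concat (map conjugates (tabulate G))
    ≡⟨ cong concat (map-tabulate G conjugates) ⟩
  concat (tabulate (conjugates ∘ G))
    ≡⟨ cong concat (tabulate-cong λ d → map-upTo (λ i → rot i (G d)) _) ⟩
  concat (tabulate λ d → applyUpTo (λ i → rot i (G d)) (length (G d)))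
    ≡⟨ map-positions (length ∘ G) (conjugateOf G) ⟨
  map (conjugateOf G) (positions (length ∘ G))
    ∎
  where open ≡-Reasoning

trailingRotations : Str σ → Str σ → List (Str σ)
trailingRotations W E = applyUpTo (λ i → rot (length W + i) (W ++ E)) (length E)

conjugates-concat : (G : Fin m → Str σ) (E : Str σ) →
  conjugates (concat (tabulate G) ++ E) ≡ map (rotationOf G E) (positions (length ∘ G)) ++ trailingRotations (concat (tabulate G)) E
conjugates-concat G E = begin
  map (λ r → rot r X) (upTo (length X))                          ≡⟨ map-upTo (λ r → rot r X) (length X) ⟩
  applyUpTo (λ r → rot r X) (length X)                           ≡⟨ cong (applyUpTo (λ r → rot r X)) (length-++ W) ⟩
  applyUpTo (λ r → rot r X) (length W + length E)                ≡⟨ applyUpTo-+ (λ r → rot r X) (length W) (length E) ⟩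
  applyUpTo (λ r → rot r X) (length W) ++ trailingRotations W E
    ≡⟨ cong (_++ trailingRotations W E) (applyUpTo-concat G (λ r → rot r X)) ⟩
  map (rotationOf G E) (positions (length ∘ G)) ++ trailingRotations W E ∎
  where
  open ≡-Reasoning
  W = concat (tabulate G)
  X = W ++ E

terminated : Coll σ m → (Fin m → Sym σ) → Fin m → Str σ
terminated N s d = embed (N d) ++ [ s d ]

mdolSep : Fin m → Sym σ
mdolSep d = sep (suc (toℕ d))

dolSep : Fin m → Sym σ
dolSep _ = dol

positionsOf : Coll σ m → List (Pos m)
positionsOf N = positions (λ d → suc (length (N d)))

Valid : Coll σ m → Pos m → Set
Valid N a = proj₂ a ℕ.≤ length (N (proj₁ a))

positionsOf-valid : (N : Coll σ m) → All (Valid N) (positionsOf N)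
positionsOf-valid N = All.map ℕ.s≤s⁻¹ (positions-valid _)

length-terminated : (N : Coll σ m) (s : Fin m → Sym σ) (d : Fin m) → length (terminated N s d) ≡ suc (length (N d))
length-terminated N s d = trans (length-++ (embed (N d))) (trans (ℕ.+-comm _ 1) (cong suc (length-map chr (N d))))

terminated-nonempty : (N : Coll σ m) (s : Fin m → Sym σ) (d : Fin m) → 0 ℕ.< length (terminated N s d)
terminated-nonempty N s d = subst (0 ℕ.<_) (sym (length-terminated N s d)) (s≤s z≤n)

positions-terminated : (N : Coll σ m) (s : Fin m → Sym σ) → positions (length ∘ terminated N s) ≡ positionsOf N
positions-terminated N s = cong concat (tabulate-cong λ d → cong (applyUpTo (d ,_)) (length-terminated N s d))

concatMap-conjugates-terminated : (N : Coll σ m) (s : Fin m → Sym σ) →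
  concatMap conjugates (tabulate (terminated N s)) ≡ map (conjugateOf (terminated N s)) (positionsOf N)
concatMap-conjugates-terminated N s =
  trans (concatMap-conjugates (terminated N s)) (cong (map _) (positions-terminated N s))

conjugates-concat-terminated : (N : Coll σ m) (s : Fin m → Sym σ) (E : Str σ) →
  conjugates (concat (tabulate (terminated N s)) ++ E) ≡
  map (rotationOf (terminated N s) E) (positionsOf N) ++ trailingRotations (concat (tabulate (terminated N s))) E
conjugates-concat-terminated N s E =
  trans (conjugates-concat (terminated N s) E)
        (cong (λ Z → map (rotationOf (terminated N s) E) Z ++ trailingRotations (concat (tabulate (terminated N s))) E)
              (positions-terminated N s))

key : Coll σ m → (Fin m → Sym σ) → Pos m → Str σ
key N s (d , i) = embed (drop i (N d)) ++ [ s d ]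

drop-terminated : (N : Coll σ m) (s : Fin m → Sym σ) {d : Fin m} {i : ℕ} → Valid N (d , i) →
  drop i (terminated N s d) ≡ key N s (d , i)
drop-terminated N s {d} {i} i≤ =
  trans (drop-++ˡ i (embed (N d)) _ (subst (i ℕ.≤_) (sym (length-map chr (N d))) i≤)) (cong (_++ [ s d ]) (drop-map i (N d)))

key-prefix-conjugate : (N : Coll σ m) (s : Fin m → Sym σ) {a : Pos m} → Valid N a →
  key N s a isPrefixOf conjugateOf (terminated N s) a
key-prefix-conjugate N s {d , i} i≤ = take i (terminated N s d) , cong (_++ take i (terminated N s d)) (drop-terminated N s i≤)

rotationOf-terminated : (N : Coll σ m) (s : Fin m → Sym σ) (E : Str σ) {d : Fin m} {i : ℕ} → Valid N (d , i) →
  let G = terminated N s in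
  rotationOf G E (d , i) ≡ key N s (d , i) ++ (after G E d ++ take (offset G d + i) (concat (tabulate G) ++ E))
rotationOf-terminated N s E {d} {i} i≤ = begin
  drop (offset G d + i) X ++ take (offset G d + i) X        ≡⟨ cong (_++ take (offset G d + i) X) drop-key ⟩
  (key N s (d , i) ++ after G E d) ++ take (offset G d + i) X ≡⟨ ++-assoc (key N s (d , i)) _ _ ⟩
  key N s (d , i) ++ (after G E d ++ take (offset G d + i) X) ∎
  where
  open ≡-Reasoning
  G = terminated N s
  X = concat (tabulate G) ++ E
  i≤|Gd| : i ℕ.≤ length (G d)
  i≤|Gd| = ℕ.≤-trans i≤ (subst (length (N d) ℕ.≤_) (sym (length-terminated N s d)) (ℕ.n≤1+n _))
  drop-key : drop (offset G d + i) X ≡ key N s (d , i) ++ after G E d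
  drop-key = begin
    drop (offset G d + i) X         ≡⟨ drop-drop (offset G d) i X ⟨
    drop i (drop (offset G d) X)    ≡⟨ cong (drop i) (drop-offset G E d) ⟩
    drop i (G d ++ after G E d)     ≡⟨ drop-++ˡ i (G d) _ i≤|Gd| ⟩
    drop i (G d) ++ after G E d     ≡⟨ cong (_++ after G E d) (drop-terminated N s i≤) ⟩
    key N s (d , i) ++ after G E d  ∎

key-prefix-rotation : (N : Coll σ m) (s : Fin m → Sym σ) (E : Str σ) {a : Pos m} → Valid N a →
  key N s a isPrefixOf rotationOf (terminated N s) E a
key-prefix-rotation N s E {d , i} i≤ = _ , rotationOf-terminated N s E i≤

-- Last symbols

-- The symbol that precedes position i of T_d $ cyclically, with every separator read as $.
bwtSymbol : Coll σ m → Pos m → Sym σ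
bwtSymbol N (d , zero)  = dol
bwtSymbol N (d , suc k) = at (embed (N d)) k

lastSym-++ : (xs : Str σ) {ys : Str σ} → ys ≢ [] → lastSym (xs ++ ys) ≡ lastSym ys
lastSym-++ []            ys≢[] = refl
lastSym-++ (x ∷ []) {[]}    ys≢[] = ⊥-elim (ys≢[] refl)
lastSym-++ (x ∷ []) {_ ∷ _} ys≢[] = refl
lastSym-++ (x ∷ x′ ∷ xs)   ys≢[] = lastSym-++ (x′ ∷ xs) ys≢[]

lastSym-rot-suc : (S : Str σ) {k : ℕ} → k ℕ.< length S → lastSym (rot (suc k) S) ≡ at S k
lastSym-rot-suc S {k} k< = trans (lastSym-++ (drop (suc k) S) (take-suc-nonempty S k<)) (lastSym-take-suc S k<)
  where
  take-suc-nonempty : (S : Str σ) {k : ℕ} → k ℕ.< length S → take (suc k) S ≢ []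
  take-suc-nonempty (_ ∷ _) _ ()
  lastSym-take-suc : (S : Str σ) {k : ℕ} → k ℕ.< length S → lastSym (take (suc k) S) ≡ at S k
  lastSym-take-suc (x ∷ S)      {zero}  _         = refl
  lastSym-take-suc (x ∷ y ∷ S)  {suc k} (s≤s k<) = lastSym-take-suc (y ∷ S) k<

lastSym-rot-offset : (G : Fin m → Str σ) (E : Str σ) (d : Fin m) {k : ℕ} → k ℕ.< length (G d) →
  lastSym (rot (suc (offset G d + k)) (concat (tabulate G) ++ E)) ≡ at (G d) k
lastSym-rot-offset G E d {k} k< with concat-tabulate-split G E d
... | P , Q , X≡ , |P|≡ = begin
  lastSym (rot (suc (offset G d + k)) (concat (tabulate G) ++ E))
    ≡⟨ cong₂ (λ n X → lastSym (rot (suc (n + k)) X)) (sym |P|≡) X≡ ⟩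
  lastSym (rot (suc (length P + k)) (P ++ (G d ++ Q)))           ≡⟨ lastSym-rot-suc (P ++ (G d ++ Q)) P+k< ⟩
  at (P ++ (G d ++ Q)) (length P + k)                            ≡⟨ at-++ʳ P _ k ⟩
  at (G d ++ Q) k                                                ≡⟨ at-++ˡ (G d) Q k< ⟩
  at (G d) k                                                     ∎
  where
  open ≡-Reasoning
  P+k< : length P + k ℕ.< length (P ++ (G d ++ Q))
  P+k< = subst (length P + k ℕ.<_) (sym (length-++ P))
           (ℕ.+-monoʳ-< (length P) (ℕ.<-≤-trans k< (subst (length (G d) ℕ.≤_) (sym (length-++ (G d))) (ℕ.m≤m+n _ _))))

module _ (norm : Sym σ → Sym σ) (norm-chr : ∀ c → norm (chr c) ≡ chr c)
         (N : Coll σ m) (s : Fin m → Sym σ) (norm-s : ∀ d → norm (s d) ≡ dol) where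

  private
    norm-at-embed : (w : List (Fin σ)) {k : ℕ} → k ℕ.< length w → norm (at (embed w) k) ≡ at (embed w) k
    norm-at-embed (c ∷ w) {zero}  _        = norm-chr c
    norm-at-embed (c ∷ w) {suc k} (s≤s k<) = norm-at-embed w k<

    at-terminated : {d : Fin m} {k : ℕ} → k ℕ.< length (N d) → at (terminated N s d) k ≡ at (embed (N d)) k
    at-terminated {d} k< = at-++ˡ (embed (N d)) _ (subst (_ ℕ.<_) (sym (length-map chr (N d))) k<)

    at-terminated-end : (w : List (Fin σ)) (t : Sym σ) → at (embed w ++ [ t ]) (length w) ≡ t
    at-terminated-end []      t = refl
    at-terminated-end (_ ∷ w) t = at-terminated-end w t

    <-length-terminated : {d : Fin m} {k : ℕ} → k ℕ.≤ length (N d) → k ℕ.< length (terminated N s d)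
    <-length-terminated {d} k≤ = subst (_ ℕ.<_) (sym (length-terminated N s d)) (s≤s k≤)

  lastSym-conjugateOf : {a : Pos m} → Valid N a → norm (lastSym (conjugateOf (terminated N s) a)) ≡ bwtSymbol N a
  lastSym-conjugateOf {d , zero} _ =
    trans (cong norm (trans (cong lastSym (++-identityʳ (terminated N s d))) (lastSym-++ (embed (N d)) (λ ())))) (norm-s d)
  lastSym-conjugateOf {d , suc k} k< =
    trans (cong norm (trans (lastSym-rot-suc (terminated N s d) (<-length-terminated (ℕ.<⇒≤ k<))) (at-terminated k<))) (norm-at-embed (N d) k<)

  -- Assumed only when m > 0: for m = 0 and E = [] it fails, lastSym [] being the junk value hash.
  lastSym-rotationOf : (E : Str σ) → (Fin m → norm (lastSym (concat (tabulate (terminated N s)) ++ E)) ≡ dol) →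
    {a : Pos m} → Valid N a → norm (lastSym (rotationOf (terminated N s) E a)) ≡ bwtSymbol N a
  lastSym-rotationOf E last≡ {d , suc k} k< = begin
    norm (lastSym (rot (offset G d + suc k) X))   ≡⟨ cong (λ r → norm (lastSym (rot r X))) (ℕ.+-suc (offset G d) k) ⟩
    norm (lastSym (rot (suc (offset G d + k)) X)) ≡⟨ cong norm (lastSym-rot-offset G E d (<-length-terminated (ℕ.<⇒≤ k<))) ⟩
    norm (at (G d) k)                             ≡⟨ cong norm (at-terminated k<) ⟩
    norm (at (embed (N d)) k)                     ≡⟨ norm-at-embed (N d) k< ⟩
    at (embed (N d)) k                            ∎
    where
    open ≡-Reasoning
    G = terminated N s
    X = concat (tabulate G) ++ E
  lastSym-rotationOf E last≡ {Fin.zero , zero} _ =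
    trans (cong (λ X → norm (lastSym X)) (++-identityʳ (concat (tabulate (terminated N s)) ++ E))) (last≡ Fin.zero)
  lastSym-rotationOf E last≡ {Fin.suc d , zero} _ = begin
    norm (lastSym (rot (offset G (Fin.suc d) + 0) X))            ≡⟨ cong (λ r → norm (lastSym (rot r X))) previous-end ⟩
    norm (lastSym (rot (suc (offset G d′ + length (N d′))) X))   ≡⟨ cong norm (lastSym-rot-offset G E d′ (<-length-terminated ℕ.≤-refl)) ⟩
    norm (at (G d′) (length (N d′)))                             ≡⟨ cong norm (at-terminated-end (N d′) (s d′)) ⟩
    norm (s d′)                                                  ≡⟨ norm-s d′ ⟩
    dol                                                          ∎
    where
    open ≡-Reasoning
    G = terminated N s
    X = concat (tabulate G) ++ E
    d′ = Fin.inject₁ d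
    previous-end : offset G (Fin.suc d) + 0 ≡ suc (offset G d′ + length (N d′))
    previous-end = begin
      offset G (Fin.suc d) + 0            ≡⟨ ℕ.+-identityʳ _ ⟩
      offset G (Fin.suc d)                ≡⟨ offset-suc G d ⟩
      offset G d′ + length (G d′)         ≡⟨ cong (offset G d′ +_) (length-terminated N s d′) ⟩
      offset G d′ + suc (length (N d′))   ≡⟨ ℕ.+-suc _ _ ⟩
      suc (offset G d′ + length (N d′))   ∎

lastSym-concat-terminated : (N : Coll σ (suc m)) (s : Fin (suc m) → Sym σ) →
  lastSym (concat (tabulate (terminated N s))) ≡ s (Fin.fromℕ m)
lastSym-concat-terminated {m = zero} N s =
  trans (cong lastSym (++-identityʳ (terminated N s Fin.zero))) (lastSym-++ (embed (N Fin.zero)) (λ ()))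
lastSym-concat-terminated {m = suc m} N s =
  trans (lastSym-++ (terminated N s Fin.zero) (nonempty (N (Fin.suc Fin.zero))))
        (lastSym-concat-terminated (N ∘ Fin.suc) (s ∘ Fin.suc))
  where
  nonempty : ∀ w {t ys} → (embed w ++ [ t ]) ++ ys ≢ []
  nonempty []      ()
  nonempty (_ ∷ _) ()

mdol-last-symbol : (N : Coll σ m) → Fin m → unsep (lastSym (concat (tabulate (terminated N mdolSep)) ++ [])) ≡ dol
mdol-last-symbol {m = suc m} N _ =
  cong unsep (trans (cong lastSym (++-identityʳ (concat (tabulate (terminated N mdolSep))))) (lastSym-concat-terminated N mdolSep))

-- The multidollar BWTs

mdolConjugate : Coll σ m → Pos m → Str σ
mdolConjugate N = conjugateOf (terminated N mdolSep)

mdolRotation : Coll σ m → Pos m → Str σ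
mdolRotation N = rotationOf (terminated N mdolSep) []

KeyDetermined : (Str σ → Str σ → Set) → Set
KeyDetermined _≺_ = ∀ {k k′ S T} → k <ᵐ k′ → k isPrefixOf S → k′ isPrefixOf T → S ≺ T

embed-injective : {v w : List (Fin σ)} → embed v ≡ embed w → v ≡ w
embed-injective = map-injective λ { refl → refl }

-- Comparing the keys T_d[i..] s_d decides both _≺_ and the mdol order, except between equal suffixes
-- of distinct strings; that case is the hypothesis tie-break.
module _ (N : Coll σ m) (s : Fin m → Sym σ) (s-terminates : ∀ d → Terminator (s d))
         (f : Pos m → Str σ) (f-key : ∀ {a} → Valid N a → key N s a isPrefixOf f a)
         {_≺_ : Str σ → Str σ → Set} (≺-key : KeyDetermined _≺_) (≺-asym : ∀ {a b} → f a ≺ f b → ¬ f b ≺ f a)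
         (tie-break : ∀ {p i q j} → Valid N (p , i) → Valid N (q , j) → q Fin.< p →
                        drop i (N p) ≡ drop j (N q) → ¬ f (p , i) ≺ f (q , j))
  where

  ≺⇒mdolRotation-<lex : ∀ {a b} → Valid N a → Valid N b → f a ≺ f b → mdolRotation N a <lex mdolRotation N b
  ≺⇒mdolRotation-<lex {p , i} {q , j} va vb fa≺fb with compare-words (embed (drop i (N p))) (embed (drop j (N q)))
  ... | inj₁ u◁v = <ᵐ-prefixes⇒<lex (u◁v _ (Terminator⇒below-embed (sep _) (drop j (N q))))
                     (key-prefix-rotation N mdolSep [] va) (key-prefix-rotation N mdolSep [] vb)
  ... | inj₂ (inj₂ v◁u) =
    ⊥-elim (≺-asym fa≺fb (≺-key (v◁u _ (Terminator⇒below-embed (s-terminates q) (drop i (N p)))) (f-key vb) (f-key va)))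
  ... | inj₂ (inj₁ u≡v) with Fin.<-cmp p q
  ...   | tri< p<q _ _ = <ᵐ-prefixes⇒<lex separators (key-prefix-rotation N mdolSep [] va) (key-prefix-rotation N mdolSep [] vb)
    where
    separators : key N mdolSep (p , i) <ᵐ key N mdolSep (q , j)
    separators = subst (λ w → (w ++ [ mdolSep p ]) <ᵐ key N mdolSep (q , j)) (sym u≡v) (++-<ᵐ _ (here (s<s (s≤s p<q))))
  ...   | tri> _ _ q<p = ⊥-elim (tie-break va vb q<p (embed-injective u≡v) fa≺fb)
  ...   | tri≈ _ refl _ with drop-injective (N p) va vb (embed-injective u≡v)
  ...     | refl = ⊥-elim (≺-asym fa≺fb fa≺fb)

mdolSep-terminates : (d : Fin m) → Terminator (mdolSep {σ = σ} d)
mdolSep-terminates d = sep _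

dolSep-terminates : (d : Fin m) → Terminator (dolSep {σ = σ} d)
dolSep-terminates d = dol

≺ω-key : KeyDetermined (_≺ω_ {σ})
≺ω-key k<k′ kS k′T = inj₁ (<ᵐ-prefixes⇒<ω-lex k<k′ kS k′T)

module _ (N : Coll σ m) {s : Fin m → Sym σ} (s-terminates : ∀ d → Terminator (s d)) where

  private
    conj = conjugateOf (terminated N s)

  conjugate-single : (a : Pos m) → SingleTerminator (conj a)
  conjugate-single (d , i) = trans (terminatorCount-rot i _) (terminated-single (s-terminates d) (N d))

  conjugate-≺ω-asym : ∀ {a b} → conj a ≺ω conj b → ¬ conj b ≺ω conj a
  conjugate-≺ω-asym {a} {b} = ≺ω-asym (conjugate-single a) (conjugate-single b)

  conjugate-≮ω-trans : ∀ {a b c} → ¬ conj b ≺ω conj a → ¬ conj c ≺ω conj b → ¬ conj c ≺ω conj a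
  conjugate-≮ω-trans {a} {b} {c} = ≮ω-trans (conjugate-single a) (conjugate-single b) (conjugate-single c)

  conjugate-≮ω-antisym : ∀ {a b} → ¬ conj a ≺ω conj b → ¬ conj b ≺ω conj a → conj a ≡ conj b
  conjugate-≮ω-antisym {a} {b} = ≮ω-antisym (conjugate-single a) (conjugate-single b)

mdolConjugate-≺ω⇒mdolRotation-<lex : (N : Coll σ m) {a b : Pos m} → Valid N a → Valid N b →
  mdolConjugate N a ≺ω mdolConjugate N b → mdolRotation N a <lex mdolRotation N b
mdolConjugate-≺ω⇒mdolRotation-<lex N = ≺⇒mdolRotation-<lex N mdolSep mdolSep-terminates (mdolConjugate N)
  (key-prefix-conjugate N mdolSep) ≺ω-key (λ {a} {b} → conjugate-≺ω-asym N mdolSep-terminates {a} {b}) tie-break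
  where
  tie-break : ∀ {p i q j} → Valid N (p , i) → Valid N (q , j) → q Fin.< p → drop i (N p) ≡ drop j (N q) →
    ¬ mdolConjugate N (p , i) ≺ω mdolConjugate N (q , j)
  tie-break {p} {i} {q} {j} vp vq q<p suffix≡ =
    conjugate-≺ω-asym N mdolSep-terminates {q , j} {p , i}
      (≺ω-key separators (key-prefix-conjugate N mdolSep vq) (key-prefix-conjugate N mdolSep vp))
    where
    separators : key N mdolSep (q , j) <ᵐ key N mdolSep (p , i)
    separators = subst (λ w → (embed w ++ [ mdolSep q ]) <ᵐ key N mdolSep (p , i)) suffix≡ (++-<ᵐ _ (here (s<s (s≤s q<p))))

mdolSortedPositions : (N : Coll σ m) → ∃ λ Z → Z ↭ positionsOf N × SortedBy (_<lex_ on mdolRotation N) Z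
mdolSortedPositions {σ} N = sort (positionsOf N) , sort-↭ (positionsOf N) , Linked.map ≤⇒≯ (sort-↗ (positionsOf N))
  where
  open Sort (On.decTotalOrder (StrictTotalOrderProperties.decTotalOrder (<lex-strictTotalOrder σ)) (mdolRotation N))
  ≤⇒≯ : {x y : Str σ} → x <lex y ⊎ x ≡ y → ¬ y <lex x
  ≤⇒≯ (inj₁ x<y)  = <lex-asym x<y
  ≤⇒≯ (inj₂ refl) = <lex-irrefl

conjugates-mdol : (N : Coll σ m) → conjugates (concat (mdolStrs N)) ≡ map (mdolRotation N) (positionsOf N)
conjugates-mdol N = begin
  conjugates (concat (mdolStrs N))            ≡⟨ cong conjugates (++-identityʳ _) ⟨
  conjugates (concat (mdolStrs N) ++ [])      ≡⟨ conjugates-concat-terminated N mdolSep [] ⟩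
  map (mdolRotation N) (positionsOf N) ++ []  ≡⟨ ++-identityʳ _ ⟩
  map (mdolRotation N) (positionsOf N)        ∎
  where open ≡-Reasoning

module _ (N : Coll σ m) {Z : List (Pos m)} (Z↭ : Z ↭ positionsOf N) (Z-sorted : SortedBy (_<lex_ on mdolRotation N) Z) where

  private
    Z-valid : All (Valid N) Z
    Z-valid = All-resp-↭ (↭-sym Z↭) (positionsOf-valid N)

  mdolBWT-of-sorted : IsMdolBWT N (map lastSym (map (mdolRotation N) Z))
  mdolBWT-of-sorted =
    map (mdolRotation N) Z ,
    ↭-trans (↭.map⁺ (mdolRotation N) Z↭) (↭-reflexive (sym (conjugates-mdol N))) ,
    Linked.map⁺ Z-sorted ,
    refl

  mdolEBWT-of-sorted : IsMdolEBWT N (map lastSym (map (mdolConjugate N) Z))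
  mdolEBWT-of-sorted =
    map (mdolConjugate N) Z ,
    ↭-trans (↭.map⁺ (mdolConjugate N) Z↭) (↭-reflexive (sym (concatMap-conjugates-terminated N mdolSep))) ,
    Linked.map⁺ (Linked-map-All (λ va vb b≮a b≺a → b≮a (mdolConjugate-≺ω⇒mdolRotation-<lex N vb va b≺a)) Z-valid Z-sorted) ,
    refl

  mdol-bwtSymbols : (f : Pos m → Str σ) → (∀ {a} → Valid N a → unsep (lastSym (f a)) ≡ bwtSymbol N a) →
    map unsep (map lastSym (map f Z)) ≡ map (bwtSymbol N) Z
  mdol-bwtSymbols f symbol≡ = begin
    map unsep (map lastSym (map f Z))  ≡⟨ cong (map unsep) (map-∘ Z) ⟨
    map unsep (map (lastSym ∘ f) Z)    ≡⟨ map-∘ Z ⟨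
    map (unsep ∘ lastSym ∘ f) Z        ≡⟨ map-cong-local (All.map symbol≡ Z-valid) ⟩
    map (bwtSymbol N) Z                ∎
    where open ≡-Reasoning

reorder : Coll σ m → Permutation′ m → Coll σ m
reorder M τ d = M (τ ⟨$⟩ʳ d)

bwtSymbol-reindex : (M : Coll σ m) (τ : Permutation′ m) (a : Pos m) → bwtSymbol M (reindex τ a) ≡ bwtSymbol (reorder M τ) a
bwtSymbol-reindex M τ (p , zero)  = refl
bwtSymbol-reindex M τ (p , suc k) = refl

-- C and the mdol transforms of reorder M τ list the same positions, sorted by _≺_ and by an order
-- refining it, so they differ only among ties, which are equal conjugates.
module _ (M : Coll σ m) (τ : Permutation′ m) (f : Pos m → Str σ) {_≺_ : Str σ → Str σ → Set}
         (≮-trans : ∀ {a b c} → ¬ f b ≺ f a → ¬ f c ≺ f b → ¬ f c ≺ f a)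
         (≮-antisym : ∀ {a b} → ¬ f a ≺ f b → ¬ f b ≺ f a → f a ≡ f b)
         (norm : Sym σ → Sym σ) (symbol≡ : ∀ {a} → Valid M a → norm (lastSym (f a)) ≡ bwtSymbol M a)
         (refines : ∀ {a b} → Valid (reorder M τ) a → Valid (reorder M τ) b →
                      f (reindex τ a) ≺ f (reindex τ b) → mdolRotation (reorder M τ) a <lex mdolRotation (reorder M τ) b)
  where

  sorted-listing⇒mdol : ∀ {C} → C ↭ map f (positionsOf M) → SortedBy _≺_ C →
    ∃ λ L₁ → ∃ λ L₂ → IsMdolEBWT (reorder M τ) L₁ × IsMdolBWT (reorder M τ) L₂ ×
                      map norm (map lastSym C) ≡ map unsep L₁ × L₁ ≐ L₂
  sorted-listing⇒mdol C↭ C-sorted with mdolSortedPositions (reorder M τ) | ↭-map-inv f (↭-sym C↭)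
  ... | Z , Z↭ , Z-sorted | Z′ , refl , P↭Z′ =
    L₁ , L₂ , mdolEBWT-of-sorted N Z↭ Z-sorted , mdolBWT-of-sorted N Z↭ Z-sorted ,
    trans C-symbols (sym L₁-symbols) , trans L₁-symbols (sym L₂-symbols)
    where
    open ≡-Reasoning
    N = reorder M τ
    L₁ = map lastSym (map (mdolConjugate N) Z)
    L₂ = map lastSym (map (mdolRotation N) Z)
    L₁-symbols : map unsep L₁ ≡ map (bwtSymbol N) Z
    L₁-symbols = mdol-bwtSymbols N Z↭ Z-sorted (mdolConjugate N) (lastSym-conjugateOf unsep (λ _ → refl) N mdolSep (λ _ → refl))
    L₂-symbols : map unsep L₂ ≡ map (bwtSymbol N) Z
    L₂-symbols = mdol-bwtSymbols N Z↭ Z-sorted (mdolRotation N)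
                   (lastSym-rotationOf unsep (λ _ → refl) N mdolSep (λ _ → refl) [] (mdol-last-symbol N))
    g : Pos m → Sym σ
    g = norm ∘ lastSym ∘ f
    Z-valid : All (Valid N) Z
    Z-valid = All-resp-↭ (↭-sym Z↭) (positionsOf-valid N)
    τZ-sorted : SortedBy (_≺_ on f) (map (reindex τ) Z)
    τZ-sorted = Linked.map⁺ (Linked-map-All (λ va vb b≮a b≺a → b≮a (refines vb va b≺a)) Z-valid Z-sorted)
    Z′↭τZ : Z′ ↭ map (reindex τ) Z
    Z′↭τZ = ↭-trans (↭-sym P↭Z′) (↭-trans (positions-↭ _ τ) (↭.map⁺ (reindex τ) (↭-sym Z↭)))
    C-symbols : map norm (map lastSym (map f Z′)) ≡ map (bwtSymbol N) Z
    C-symbols = begin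
      map norm (map lastSym (map f Z′))   ≡⟨ trans (map-∘ Z′) (cong (map norm) (map-∘ Z′)) ⟨
      map g Z′
        ≡⟨ sorted-↭⇒map-≡ g (λ a⊀b b⊀a → cong (norm ∘ lastSym) (≮-antisym a⊀b b⊀a)) Z′↭τZ
             (Linked.Linked⇒AllPairs ≮-trans (Linked.map⁻ C-sorted)) (Linked.Linked⇒AllPairs ≮-trans τZ-sorted) ⟩
      map g (map (reindex τ) Z)
        ≡⟨ map-∘ Z ⟨
      map (g ∘ reindex τ) Z
        ≡⟨ map-cong-local (All.map (λ {a} va → trans (symbol≡ va) (bwtSymbol-reindex M τ a)) Z-valid) ⟩
      map (bwtSymbol N) Z
        ∎

MdolUpToSeparators : Coll σ m → Str σ → Set
MdolUpToSeparators {σ} {m} M L = ∃ λ (τ : Permutation′ m) → ∃ λ L₁ → ∃ λ L₂ →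
  IsMdolEBWT (reorder M τ) L₁ × IsMdolBWT (reorder M τ) L₂ × (L ≐ L₁) × (L₁ ≐ L₂)

-- The four transforms

mdolEBWT-case : (M : Coll σ m) (L : Str σ) → IsMdolEBWT M L → MdolUpToSeparators M L
mdolEBWT-case M L (C , C↭ , C-sorted , refl) =
  id , sorted-listing⇒mdol M id (mdolConjugate M)
         (λ {a} {b} {c} → conjugate-≮ω-trans M mdolSep-terminates {a} {b} {c})
         (λ {a} {b} → conjugate-≮ω-antisym M mdolSep-terminates {a} {b})
         unsep (lastSym-conjugateOf unsep (λ _ → refl) M mdolSep (λ _ → refl))
         (mdolConjugate-≺ω⇒mdolRotation-<lex M)
         (subst (C ↭_) (concatMap-conjugates-terminated M mdolSep) C↭) C-sorted

mdolBWT-case : (M : Coll σ m) (L : Str σ) → IsMdolBWT M L → MdolUpToSeparators M L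
mdolBWT-case M L (C , C↭ , C-sorted , refl) =
  id , sorted-listing⇒mdol M id (mdolRotation M) ≮lex-trans ≮lex-antisym
         unsep (lastSym-rotationOf unsep (λ _ → refl) M mdolSep (λ _ → refl) [] (mdol-last-symbol M))
         (λ _ _ a<b → a<b)
         (subst (C ↭_) (conjugates-mdol M) C↭) C-sorted

terminated-<ω-lex⇒<lex : ∀ {t} → Terminator t → (v w : List (Fin σ)) →
  (embed v ++ [ t ]) <ω-lex (embed w ++ [ t ]) → (embed v ++ [ t ]) <lex (embed w ++ [ t ])
terminated-<ω-lex⇒<lex {t = t} term v w v<w with compare-words (embed v) (embed w)
... | inj₁ v◁w        = <ᵐ⇒<lex (v◁w t (Terminator⇒below-embed term w))
... | inj₂ (inj₁ v≡w) = ⊥-elim (<ˢ-irrefl (subst (λ x → (x ++ [ t ]) <ω-lex (embed w ++ [ t ])) v≡w v<w))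
... | inj₂ (inj₂ w◁v) = ⊥-elim (<ˢ-asym v<w
                          (<ᵐ-prefixes⇒<ω-lex (w◁v t (Terminator⇒below-embed term v)) (isPrefixOf-refl _) (isPrefixOf-refl _)))

module _ (N : Coll σ m) (sorted : ∀ {p q} → terminated N dolSep p <lex terminated N dolSep q → p Fin.< q) where

  private
    T = terminated N dolSep

  -- Equal suffixes T_p[i..] $ = T_q[j..] $ make the two conjugates compare like T_p $ and T_q $.
  dol-tie-break : ∀ {p i q j} → Valid N (p , i) → Valid N (q , j) → q Fin.< p → drop i (N p) ≡ drop j (N q) →
    ¬ conjugateOf T (p , i) ≺ω conjugateOf T (q , j)
  dol-tie-break {p} {i} {q} {j} vp vq q<p suffix≡ p≺q =
    Fin.<-asym q<p (sorted (terminated-<ω-lex⇒<lex dol (N p) (N q) Tp<Tq))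
    where
    U = key N dolSep (p , i)
    drop-p : drop i (T p) ≡ U
    drop-p = drop-terminated N dolSep vp
    drop-q : drop j (T q) ≡ U
    drop-q = trans (drop-terminated N dolSep vq) (cong (λ w → embed w ++ [ dol ]) (sym suffix≡))
    rotated : (U ++ take i (T p)) <ω-lex (U ++ take j (T q))
    rotated = subst₂ _<ω-lex_ (cong (_++ take i (T p)) drop-p) (cong (_++ take j (T q)) drop-q)
                (≺ω⇒<ω-lex (conjugate-single N dolSep-terminates (p , i)) (conjugate-single N dolSep-terminates (q , j)) p≺q)
    unrotate : ∀ d k → drop k (T d) ≡ U → take k (T d) ++ U ≡ T d
    unrotate d k drop≡ = trans (cong (take k (T d) ++_) (sym drop≡)) (take++drop≡id k (T d))
    nonempty : ∀ d k → drop k (T d) ≡ U → 0 ℕ.< length (take k (T d) ++ U)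
    nonempty d k drop≡ = subst (λ x → 0 ℕ.< length x) (sym (unrotate d k drop≡)) (terminated-nonempty N dolSep d)
    Tp<Tq : T p <ω-lex T q
    Tp<Tq = subst₂ _<ω-lex_ (unrotate p i drop-p) (unrotate q j drop-q)
              (<ω-lex-rotate U (take i (T p)) (take j (T q)) (nonempty p i drop-p) (nonempty q j drop-q) rotated)

  dolConjugate-≺ω⇒mdolRotation-<lex : {a b : Pos m} → Valid N a → Valid N b →
    conjugateOf T a ≺ω conjugateOf T b → mdolRotation N a <lex mdolRotation N b
  dolConjugate-≺ω⇒mdolRotation-<lex = ≺⇒mdolRotation-<lex N dolSep dolSep-terminates (conjugateOf T)
    (key-prefix-conjugate N dolSep) ≺ω-key (λ {a} {b} → conjugate-≺ω-asym N dolSep-terminates {a} {b}) dol-tie-break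

dolEBWT-case : (M : Coll σ m) (L : Str σ) → IsDolEBWT M L → MdolUpToSeparators M L
dolEBWT-case {σ} M L (C , C↭ , C-sorted , refl) with sortingPermutation (<lex-strictTotalOrder σ) (terminated M dolSep)
... | τ , τ-sorts =
  τ , sorted-listing⇒mdol M τ (conjugateOf (terminated M dolSep))
        (λ {a} {b} {c} → conjugate-≮ω-trans M dolSep-terminates {a} {b} {c})
         (λ {a} {b} → conjugate-≮ω-antisym M dolSep-terminates {a} {b})
        unsep (lastSym-conjugateOf unsep (λ _ → refl) M dolSep (λ _ → refl))
        (dolConjugate-≺ω⇒mdolRotation-<lex (reorder M τ) τ-sorts)
        (subst (C ↭_) (concatMap-conjugates-terminated M dolSep) C↭) C-sorted

module _ (M : Coll σ m) where

  private
    G = terminated M dolSep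
    W = concat (tabulate G)
    X = W ++ [ hash ]

    W-hash-free : All (hash <S_) W
    W-hash-free = All.concat⁺ (All.tabulate⁺ λ d → All.++⁺ (Terminator⇒below-embed hash (M d)) (h<d ∷ []))

    after≡ : ∀ d → after G [ hash ] d ≡ drop (end G d) W ++ [ hash ]
    after≡ d = drop-++ˡ (end G d) W [ hash ] (end-≤-length G d)

  hashRotation : Str σ
  hashRotation = rot (length W + 0) X

  conjugates-hash : conjugates X ≡ map (rotationOf G [ hash ]) (positionsOf M) ++ [ hashRotation ]
  conjugates-hash = conjugates-concat-terminated M dolSep [ hash ]

  hashRotation∈conjugates : hashRotation ∈ conjugates X
  hashRotation∈conjugates = subst (hashRotation ∈_) (sym conjugates-hash) (∈-++⁺ʳ _ (here refl))

  hashRotation-least : {a : Pos m} → Valid M a → hashRotation <lex rotationOf G [ hash ] a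
  hashRotation-least {d , i} va = <ᵐ-prefixes⇒<lex (hash<key (drop i (M d))) hash-prefix (key-prefix-rotation M dolSep [ hash ] va)
    where
    hash<key : ∀ w → [ hash ] <ᵐ (embed w ++ [ dol ])
    hash<key []      = here h<d
    hash<key (_ ∷ _) = here h<c
    hash-prefix : [ hash ] isPrefixOf hashRotation
    hash-prefix = take (length W + 0) X , cong (_++ take (length W + 0) X) (drop-++ʳ W [ hash ] 0)

  sorted-tail-positions : ∀ {c C} → c ∷ C ↭ conjugates X → SortedBy _<lex_ (c ∷ C) →
    C ↭ map (rotationOf G [ hash ]) (positionsOf M)
  sorted-tail-positions {c} {C} c∷C↭ sorted =
    subst (C ↭_) (++-identityʳ _)
      (drop-mid [] (map (rotationOf G [ hash ]) (positionsOf M)) (subst (λ x → x ∷ C ↭ _) c≡h c∷C↭′))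
    where
    c∷C↭′ : c ∷ C ↭ map (rotationOf G [ hash ]) (positionsOf M) ++ [ hashRotation ]
    c∷C↭′ = subst (c ∷ C ↭_) conjugates-hash c∷C↭
    head-least : ∀ {y} → y ∈ c ∷ C → ¬ y <lex c
    head-least (here refl) = <lex-irrefl
    head-least (there y∈C) with Linked.Linked⇒AllPairs ≮lex-trans sorted
    ... | c≤C ∷ _ = All.lookup c≤C y∈C
    c≡h : c ≡ hashRotation
    c≡h with ∈-++⁻ (map (rotationOf G [ hash ]) (positionsOf M)) (∈-resp-↭ c∷C↭′ (here refl))
    ... | inj₂ (here c≡h) = c≡h
    ... | inj₁ c∈ with ∈-map⁻ (rotationOf G [ hash ]) c∈
    ...   | a , a∈ , c≡ = ⊥-elim (head-least (∈-resp-↭ (↭-sym c∷C↭) hashRotation∈conjugates)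
                                   (subst (hashRotation <lex_) (sym c≡) (hashRotation-least (All.lookup (positionsOf-valid M) a∈))))

  -- after G [ hash ] d is the text following T_d $; since # occurs only at its end, two of them
  -- differ at a common position unless they are equal.
  after-compare : (d e : Fin m) → after G [ hash ] d <ᵐ after G [ hash ] e ⊎ d ≡ e ⊎ after G [ hash ] e <ᵐ after G [ hash ] d
  after-compare d e with compare-words (drop (end G d) W) (drop (end G e) W)
  ... | inj₁ d◁e        = inj₁ (subst₂ _<ᵐ_ (sym (after≡ d)) (sym (after≡ e)) (d◁e hash (All.drop⁺ (end G e) W-hash-free)))
  ... | inj₂ (inj₁ d≡e) =
    inj₂ (inj₁ (end-injective G (terminated-nonempty M dolSep) (drop-injective W (end-≤-length G d) (end-≤-length G e) d≡e)))
  ... | inj₂ (inj₂ e◁d) = inj₂ (inj₂ (subst₂ _<ᵐ_ (sym (after≡ e)) (sym (after≡ d)) (e◁d hash (All.drop⁺ (end G d) W-hash-free))))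

  module _ (τ : Permutation′ m)
           (sorted : ∀ {p q} → after G [ hash ] (τ ⟨$⟩ʳ p) <lex after G [ hash ] (τ ⟨$⟩ʳ q) → p Fin.< q) where

    concat-tie-break : ∀ {p i q j} → Valid (reorder M τ) (p , i) → Valid (reorder M τ) (q , j) → q Fin.< p →
      drop i (M (τ ⟨$⟩ʳ p)) ≡ drop j (M (τ ⟨$⟩ʳ q)) →
      ¬ rotationOf G [ hash ] (reindex τ (p , i)) <lex rotationOf G [ hash ] (reindex τ (q , j))
    concat-tie-break {p} {i} {q} {j} vp vq q<p suffix≡ fp<fq with after-compare (τ ⟨$⟩ʳ p) (τ ⟨$⟩ʳ q)
    ... | inj₁ Ap<Aq        = Fin.<-asym q<p (sorted (<ᵐ⇒<lex Ap<Aq))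
    ... | inj₂ (inj₁ τp≡τq) = Fin.<-irrefl (⟨$⟩ʳ-injective τ (sym τp≡τq)) q<p
    ... | inj₂ (inj₂ Aq<Ap) = <lex-asym fp<fq (<ᵐ⇒<lex (subst₂ _<ᵐ_ (sym rotation-q) (sym (rotationOf-terminated M dolSep [ hash ] vp))
                                                             (++-<ᵐ (key M dolSep (τ ⟨$⟩ʳ p , i)) (<ᵐ-++ Aq<Ap _ _))))
      where
      rotation-q : rotationOf G [ hash ] (τ ⟨$⟩ʳ q , j) ≡
                   key M dolSep (τ ⟨$⟩ʳ p , i) ++ (after G [ hash ] (τ ⟨$⟩ʳ q) ++ take (offset G (τ ⟨$⟩ʳ q) + j) X)
      rotation-q = trans (rotationOf-terminated M dolSep [ hash ] vq) (cong (λ w → (embed w ++ [ dol ]) ++ _) (sym suffix≡))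

    concatRotation-<lex⇒mdolRotation-<lex : ∀ {a b} → Valid (reorder M τ) a → Valid (reorder M τ) b →
      rotationOf G [ hash ] (reindex τ a) <lex rotationOf G [ hash ] (reindex τ b) →
      mdolRotation (reorder M τ) a <lex mdolRotation (reorder M τ) b
    concatRotation-<lex⇒mdolRotation-<lex = ≺⇒mdolRotation-<lex (reorder M τ) dolSep dolSep-terminates
      (rotationOf G [ hash ] ∘ reindex τ) (λ { {p , i} vp → key-prefix-rotation M dolSep [ hash ] vp })
      <ᵐ-prefixes⇒<lex <lex-asym concat-tie-break

  concat-bwtSymbol : {a : Pos m} → Valid M a → unsep (hashToDol (lastSym (rotationOf G [ hash ] a))) ≡ bwtSymbol M a
  concat-bwtSymbol = lastSym-rotationOf (unsep ∘ hashToDol) (λ _ → refl) M dolSep (λ _ → refl) [ hash ]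
                       (λ _ → cong (unsep ∘ hashToDol) (lastSym-++ W (λ ())))

adaptedConcatBWT-case : (M : Coll σ m) (L : Str σ) → IsAdaptedConcatBWT M L → MdolUpToSeparators M L
adaptedConcatBWT-case M L (_ , ([] , []↭ , _) , _) with ∈-resp-↭ (↭-sym []↭) (hashRotation∈conjugates M)
... | ()
adaptedConcatBWT-case {σ} M L (_ , (c ∷ C , C↭ , C-sorted , refl) , refl)
  with sortingPermutation (<lex-strictTotalOrder σ) (after (terminated M dolSep) [ hash ])
... | τ , τ-sorts
  with sorted-listing⇒mdol M τ (rotationOf (terminated M dolSep) [ hash ]) ≮lex-trans ≮lex-antisym
         (unsep ∘ hashToDol) (concat-bwtSymbol M) (concatRotation-<lex⇒mdolRotation-<lex M τ τ-sorts)
         (sorted-tail-positions M C↭ C-sorted) (Linked.tail C-sorted)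
... | L₁ , L₂ , L₁-mdolEBWT , L₂-mdolBWT , C-symbols , L₁≐L₂ =
  τ , L₁ , L₂ , L₁-mdolEBWT , L₂-mdolBWT , trans (sym (map-∘ _)) C-symbols , L₁≐L₂

-- The strings T_d need not be nonempty: the argument never uses that hypothesis.
theorem17 : ∀ {σ m} (M : Coll σ m) → (∀ d → M d ≢ []) →
    ∀ L → (IsDolEBWT M L ⊎ IsMdolEBWT M L ⊎ IsMdolBWT M L ⊎ IsAdaptedConcatBWT M L) →
    ∃ λ (τ : Permutation′ m) → ∃ λ L₁ → ∃ λ L₂ →
      IsMdolEBWT (λ d → M (τ ⟨$⟩ʳ d)) L₁ × IsMdolBWT (λ d → M (τ ⟨$⟩ʳ d)) L₂ ×
      (L ≐ L₁) × (L₁ ≐ L₂)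
theorem17 M _ L (inj₁ L-dolEBWT)                 = dolEBWT-case M L L-dolEBWT
theorem17 M _ L (inj₂ (inj₁ L-mdolEBWT))         = mdolEBWT-case M L L-mdolEBWT
theorem17 M _ L (inj₂ (inj₂ (inj₁ L-mdolBWT)))   = mdolBWT-case M L L-mdolBWT
theorem17 M _ L (inj₂ (inj₂ (inj₂ L-concatBWT))) = adaptedConcatBWT-case M L L-concatBWT
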